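{- Let $R$ be an $\mathsf{MLL}$ proof-structure and $F$, $F'$ two formula occurrences in $R$. Then $\mathbf{J}_{F\to F'}(R)$ is correct (i.e. has at least one sequentialization) if and only if there exists a sequentialization of $R$ in which $F$ is above $F'$.
   Context: A proof-structure is correct (a proof-net) when its set of sequentializations (sequent calculus proofs desequentializing to it) is nonempty. $F$ is above $F'$ in a proof when the rule creating $F$ lies on the same branch as, and above, the rule using $F'$. $\mathbf{J}$ is a special atom. $\mathbf{J}_{F\to F'}(R)$ is $R$ with the following gadget grafted in, types being propagated downward: an axiom link with conclusions $\mathbf{J},\mathbf{J}^\perp$; a $\otimes$ link joining $F$ and $\mathbf{J}$ into $F\otimes\mathbf{J}$ at the position of $F$; and a par (⅋) link joining $F'$ and $\mathbf{J}^\perp$ into $\mathbf{J}^\perp⅋F'$ at the position of $F'$. Sequentializations of $\mathbf{J}_{F\to F'}(R)$ are taken in $\mathsf{MLL}_\mathbf{J}$, which is $\mathsf{MLL}$ extended with the rule $\otimes_\mathbf{J}$ (tensoring a non-$J$ formula with a $\mathbf{J}$ obtained from axiom $\vdash\mathbf{J},\mathbf{J}^\perp$) and the rule ⅋$_{\mathbf{J}^\perp}$ (parring a non-$J$ formula with $\mathbf{J}^\perp$). -}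

module Defs where

open import Data.Nat using (ℕ; _+_)
open import Data.Fin using (Fin; zero; suc; _↑ˡ_; _↑ʳ_; _≟_)
open import Data.Bool using (if_then_else_)
open import Data.List using (List; []; _∷_) renaming (_++_ to _++ₗ_)
open import Data.List.Membership.Propositional using (_∈_)
open import Data.List.Relation.Unary.Unique.Propositional using (Unique)
open import Data.List.Relation.Binary.Permutation.Propositional using (_↭_)
open import Data.Maybe using (Maybe; just; nothing)
open import Data.Product using (Σ; _×_; ∃; ∃-syntax)
open import Data.Sum using (_⊎_)
open import Data.Empty using (⊥)
open import Data.Unit using (⊤)
open import Relation.Nullary using (¬_; does)
open import Relation.Binary.PropositionalEquality using (_≡_; _≢_)
open import Function.Bundles using (_⇔_)

infixr 6 _⊗_
infixr 5 _⅋_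

data Formula : Set where
  atom  : ℕ → Formula
  atom⊥ : ℕ → Formula
  J     : Formula
  J⊥    : Formula
  _⊗_   : Formula → Formula → Formula
  _⅋_   : Formula → Formula → Formula

dual : Formula → Formula
dual (atom i)  = atom⊥ i
dual (atom⊥ i) = atom i
dual J         = J⊥
dual J⊥        = J
dual (A ⊗ B)   = dual B ⅋ dual A
dual (A ⅋ B)   = dual B ⊗ dual A

data NoJ : Formula → Set where
  atom  : ∀ i → NoJ (atom i)
  atom⊥ : ∀ i → NoJ (atom⊥ i)
  _⊗_   : ∀ {A B} → NoJ A → NoJ B → NoJ (A ⊗ B)
  _⅋_   : ∀ {A B} → NoJ A → NoJ B → NoJ (A ⅋ B)

NotJAtom : Formula → Set
NotJAtom A = (A ≢ J) × (A ≢ J⊥)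

-- Vertices (formula occurrences) are Fin n; every
-- vertex is the conclusion of exactly one link, recorded by `link v`:
--   ax w     : v is a conclusion of the axiom link with conclusions v , w
--   tens a b : v is the conclusion of a ⊗ link with premises a (left), b (right)
--   par a b  : v is the conclusion of a ⅋ link with premises a (left), b (right)

data Link (n : ℕ) : Set where
  ax   : Fin n → Link n
  tens : Fin n → Fin n → Link n
  par  : Fin n → Fin n → Link n

data Side : Set where
  left right : Side

premAt : ∀ {n} → Link n → Side → Maybe (Fin n)
premAt (ax _)     _     = nothing
premAt (tens a b) left  = just a
premAt (tens a b) right = just b
premAt (par a b)  left  = just a
premAt (par a b)  right = just b

record ProofStructure (n : ℕ) : Set where
  field
    lab  : Fin n → Formula
    link : Fin n → Link n
    ax-sym  : ∀ v w → link v ≡ ax w → link w ≡ ax v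
    ax-irr  : ∀ v w → link v ≡ ax w → v ≢ w
    ax-dual : ∀ v w → link v ≡ ax w → lab w ≡ dual (lab v)
    tens-lab : ∀ v a b → link v ≡ tens a b → lab v ≡ lab a ⊗ lab b
    par-lab  : ∀ v a b → link v ≡ par a b → lab v ≡ lab a ⅋ lab b
    premise-once : ∀ u v s v' s' → premAt (link v) s ≡ just u →
                   premAt (link v') s' ≡ just u → (v ≡ v') × (s ≡ s')
  -- (acyclicity of the premise relation follows from the typing)

open ProofStructure public

IsMLL : ∀ {n} → ProofStructure n → Set
IsMLL R = ∀ v → NoJ (lab R v)

IsConclusion : ∀ {n} → ProofStructure n → Fin n → Set
IsConclusion R v = ∀ w s → premAt (link R w) s ≢ just v

-- Sequent calculus MLL_J, with formula occurrences taken as vertices of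
-- the structure (a derivation of type Proof S Γ is a proof whose
-- occurrences are those of S, i.e. which desequentializes into S).
-- For a J-free structure the J-rules can never fire, so this is MLL.

module _ {n : ℕ} (S : ProofStructure n) where

  data Proof : List (Fin n) → Set where
    ax-r : ∀ {v w} → link S v ≡ ax w → NoJ (lab S v) →
           Proof (v ∷ w ∷ [])
    ⊗-r  : ∀ {v a b Γ Δ} → link S v ≡ tens a b →
           Proof (a ∷ Γ) → Proof (b ∷ Δ) → Proof (v ∷ Γ ++ₗ Δ)
    ⅋-r  : ∀ {v a b Γ} → link S v ≡ par a b →
           Proof (a ∷ b ∷ Γ) → Proof (v ∷ Γ)
    -- ⊗_J : from ⊢ Γ, A and the axiom ⊢ J, J⊥ derive ⊢ Γ, A ⊗ J, J⊥
    ⊗J-r : ∀ {v a j k Γ} → link S v ≡ tens a j → link S j ≡ ax k →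
           lab S j ≡ J → NotJAtom (lab S a) →
           Proof (a ∷ Γ) → Proof (v ∷ k ∷ Γ)
    ⅋J-r : ∀ {v k a Γ} → link S v ≡ par k a → lab S k ≡ J⊥ →
           NotJAtom (lab S a) →
           Proof (k ∷ a ∷ Γ) → Proof (v ∷ Γ)
    ex-r : ∀ {Γ Δ} → Γ ↭ Δ → Proof Γ → Proof Δ

  Creates : ∀ {Γ} → Fin n → Proof Γ → Set
  Creates x (ax-r {v} {w} _ _)         = (x ≡ v) ⊎ (x ≡ w)
  Creates x (⊗-r {v} _ _ _)            = x ≡ v
  Creates x (⅋-r {v} _ _)              = x ≡ v
  Creates x (⊗J-r {v} {a} {j} {k} _ _ _ _ _) = (x ≡ v) ⊎ ((x ≡ j) ⊎ (x ≡ k))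
  Creates x (⅋J-r {v} _ _ _ _)         = x ≡ v
  Creates x (ex-r _ _)                 = ⊥

  Uses : ∀ {Γ} → Fin n → Proof Γ → Set
  Uses x (ax-r _ _)                    = ⊥
  Uses x (⊗-r {v} {a} {b} _ _ _)       = (x ≡ a) ⊎ (x ≡ b)
  Uses x (⅋-r {v} {a} {b} _ _)         = (x ≡ a) ⊎ (x ≡ b)
  Uses x (⊗J-r {v} {a} {j} _ _ _ _ _)  = (x ≡ a) ⊎ (x ≡ j)
  Uses x (⅋J-r {v} {k} {a} _ _ _ _)    = (x ≡ k) ⊎ (x ≡ a)
  Uses x (ex-r _ _)                    = ⊥

  data _◃_ : ∀ {Δ Γ} → Proof Δ → Proof Γ → Set where
    ⊗-l◃ : ∀ {v a b Γ Δ} {e : link S v ≡ tens a b}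
             {π₁ : Proof (a ∷ Γ)} {π₂ : Proof (b ∷ Δ)} → π₁ ◃ ⊗-r e π₁ π₂
    ⊗-r◃ : ∀ {v a b Γ Δ} {e : link S v ≡ tens a b}
             {π₁ : Proof (a ∷ Γ)} {π₂ : Proof (b ∷ Δ)} → π₂ ◃ ⊗-r e π₁ π₂
    ⅋◃   : ∀ {v a b Γ} {e : link S v ≡ par a b}
             {π : Proof (a ∷ b ∷ Γ)} → π ◃ ⅋-r e π
    ⊗J◃  : ∀ {v a j k Γ} {e : link S v ≡ tens a j} {e' : link S j ≡ ax k}
             {l : lab S j ≡ J} {nj : NotJAtom (lab S a)}
             {π : Proof (a ∷ Γ)} → π ◃ ⊗J-r e e' l nj π
    ⅋J◃  : ∀ {v k a Γ} {e : link S v ≡ par k a} {l : lab S k ≡ J⊥}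
             {nj : NotJAtom (lab S a)}
             {π : Proof (k ∷ a ∷ Γ)} → π ◃ ⅋J-r e l nj π
    ex◃  : ∀ {Γ Δ} {p : Γ ↭ Δ} {π : Proof Γ} → π ◃ ex-r p π

  data _≼_ : ∀ {Δ Γ} → Proof Δ → Proof Γ → Set where
    here  : ∀ {Γ} {π : Proof Γ} → π ≼ π
    there : ∀ {Θ Δ Γ} {ρ : Proof Θ} {π' : Proof Δ} {π : Proof Γ} →
            ρ ≼ π' → π' ◃ π → ρ ≼ π

  CreatedIn : ∀ {Γ} → Fin n → Proof Γ → Set
  CreatedIn x π = ∃[ Θ ] Σ (Proof Θ) λ ρ → (ρ ≼ π) × Creates x ρ

  -- "F is above F' in π": the rule creating F lies above the rule using F',
  -- on the branch carrying F' (i.e. inside the premise of that rule whose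
  -- sequent contains F').  If F' is never used (it is a conclusion), the
  -- "rule using F'" is the end of the proof, and the condition is that F
  -- is created in π.
  Above : ∀ {Γ} → Fin n → Fin n → Proof Γ → Set
  Above {Γ} F F' π =
      ((F' ∈ Γ) × CreatedIn F π)
    ⊎ (∃[ Δ ] Σ (Proof Δ) λ σ → (σ ≼ π) × Uses F' σ ×
        (∃[ Θ ] Σ (Proof Θ) λ π' → (π' ◃ σ) × (F' ∈ Θ) × CreatedIn F π'))

  ConclusionList : List (Fin n) → Set
  ConclusionList Γ = Unique Γ × (∀ v → (v ∈ Γ) ⇔ IsConclusion S v)

  record Sequentialization : Set where
    field
      concl    : List (Fin n)
      isConcl  : ConclusionList concl
      proof    : Proof concl

  Correct : Set
  Correct = Sequentialization

open Sequentialization public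

-- Vertices of J_{F→F'}(R) are Fin (n + 4):
-- the old vertex v is  v ↑ˡ 4 , and the four new ones are
--   jv  : J            (axiom with j⊥v)
--   j⊥v : J⊥           (axiom with jv)
--   tv  : F ⊗ J        (⊗ link with premises F, J; takes F's place)
--   pv  : J⊥ ⅋ F'      (⅋ link with premises J⊥, F'; takes F''s place)

module Gadget {n : ℕ} (F F' : Fin n) where

  old : Fin n → Fin (n + 4)
  old v = v ↑ˡ 4

  jv j⊥v tv pv : Fin (n + 4)
  jv  = n ↑ʳ zero
  j⊥v = n ↑ʳ suc zero
  tv  = n ↑ʳ suc (suc zero)
  pv  = n ↑ʳ suc (suc (suc zero))

  re : Fin n → Fin (n + 4)
  re x = if does (x ≟ F) then tv else (if does (x ≟ F') then pv else old x)

  relink : Link n → Link (n + 4)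
  relink (ax w)     = ax (old w)
  relink (tens a b) = tens (re a) (re b)
  relink (par a b)  = par (re a) (re b)

  -- S is J_{F→F'}(R): same graph with the gadget grafted in, same axiom
  -- formulas; all other types are then forced (propagated downward) by the
  -- typing conditions of ProofStructure.
  record IsJGraft (R : ProofStructure n) (S : ProofStructure (n + 4)) : Set where
    field
      link-old : ∀ v → link S (old v) ≡ relink (link R v)
      link-j   : link S jv ≡ ax j⊥v
      link-j⊥  : link S j⊥v ≡ ax jv
      link-t   : link S tv ≡ tens (old F) jv
      link-p   : link S pv ≡ par j⊥v (old F')
      lab-j    : lab S jv ≡ J
      lab-ax   : ∀ v w → link R v ≡ ax w → lab S (old v) ≡ lab R v

JGraft : ∀ {n} → ProofStructure n → Fin n → Fin n → ProofStructure (n + 4) → Set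
JGraft R F F' S = Gadget.IsJGraft F F' R S

SeqWithAbove : ∀ {n} → ProofStructure n → Fin n → Fin n → Set
SeqWithAbove R F F' = Σ (Sequentialization R) λ σ → Above R F F' (proof σ)

module Submission where

-- In any sequent proof, an occurrence is created as often as it occurs in the end
-- sequent plus the number of times it is used.
--
-- Given such a sequentialization with F above F', rename F to F ⊗ J by firing ⊗_J
-- where F is created, carry the residual J⊥ down to the rule using F', and absorb it
-- there with ⅋_J⊥; that J⊥ and F' meet in the same premise is exactly "F above F'".
-- Conversely, erasing the gadget from a sequentialization of J_{F→F'}(R) gives one of
-- R.  If F' is not a conclusion, the rule creating the link below F' uses J⊥ ⅋ F',
-- which can only be created by ⅋_J⊥ from a J⊥ created by ⊗_J, i.e. above a creation
-- of F.

open import Defs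
open import Data.Nat using (ℕ; zero; suc; _+_; _∸_; _≤_; _<_; z≤n; s≤s)
open import Data.Nat.Induction using (<-wellFounded)
open import Data.List.Extrema.Nat using (max; xs≤max)
open import Data.Nat.Properties using (≤-reflexive; suc-injective; +-suc; m+n≡0⇒m≡0; m+n≡0⇒n≡0; ∸-monoʳ-<; ≤-refl; ≤-trans; m≤m+n; m≤n+m; +-assoc; +-comm)
open import Data.Fin using (Fin; zero; suc; _↑ˡ_; _↑ʳ_; _≟_; splitAt)
open import Data.Fin.Properties using (any?; splitAt-↑ˡ; splitAt-↑ʳ; splitAt⁻¹-↑ˡ; splitAt⁻¹-↑ʳ; ↑ˡ-injective; ↑ʳ-injective)
open import Data.Bool using (if_then_else_)
open import Data.List using (List; []; _∷_; _∷ʳ_; _++_; map; mapMaybe; allFin)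
open import Data.List.Membership.Propositional using (_∈_; _∉_)
open import Data.List.Relation.Unary.Unique.Propositional using (Unique)
open import Data.List.Relation.Unary.AllPairs using (_∷_)
import Data.List.Relation.Unary.All as All
open import Function using (_∘_; id; case_of_)
import Data.Nat.Tactic.RingSolver as RingSolver
open import Data.List.Membership.Propositional.Properties using (∈-++⁻; ∈-map⁺; ∈-map⁻; ∈-allFin; ∈-∃++; ∈-++⁺ʳ)
import Data.List.Relation.Unary.Unique.Propositional.Properties as Unique
open import Data.List.Relation.Unary.Any using (here; there)
open import Data.List.Relation.Binary.Permutation.Propositional using (_↭_; ↭-sym)
import Data.List.Relation.Binary.Permutation.Propositional as ↭
open import Data.List.Relation.Binary.Permutation.Propositional.Properties using (∈-resp-↭; ∷↭∷ʳ; map⁺; shift; ++⁺ʳ; mapMaybe-↭)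
open import Data.List.Properties using (map-++; ++-assoc; map-cong-local; mapMaybe-++; mapMaybe-map-retract)
open import Data.Product using (Σ; _×_; _,_; proj₁; proj₂; ∃-syntax)
import Data.Maybe as Maybe
open import Data.Maybe using (Maybe; just; nothing; maybe′)
open import Data.Maybe.Properties using (just-injective; ≡-dec)
import Data.Sum
open import Data.Sum using (_⊎_; inj₁; inj₂; [_,_]′)
open import Data.Empty using (⊥; ⊥-elim)
open import Relation.Nullary using (¬_; Dec; does; yes; no)
open import Relation.Nullary.Decidable using (_⊎-dec_)
open import Function.Bundles using (Equivalence; mk⇔; _⇔_)
import Induction.WellFounded as WF
import Relation.Binary.Construct.On as On
open import Relation.Binary.PropositionalEquality using (_≡_; _≢_; refl; sym; trans; cong; cong₂; subst; module ≡-Reasoning)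

-- Counting occurrences

δ : ∀ {m} → Fin m → Fin m → ℕ
δ x y with x ≟ y
... | yes _ = 1
... | no _ = 0

δ-refl : ∀ {m} (x : Fin m) → δ x x ≡ 1
δ-refl x with x ≟ x
... | yes _ = refl
... | no x≢x = ⊥-elim (x≢x refl)

δ-≢ : ∀ {m} {x y : Fin m} → x ≢ y → δ x y ≡ 0
δ-≢ {x = x} {y} x≢y with x ≟ y
... | yes x≡y = ⊥-elim (x≢y x≡y)
... | no _ = refl

δ>0⇒≡ : ∀ {m} {x y : Fin m} → 0 < δ x y → x ≡ y
δ>0⇒≡ {x = x} {y} p with x ≟ y
... | yes x≡y = x≡y

≡⇒δ>0 : ∀ {m} {x y : Fin m} → x ≡ y → 0 < δ x y
≡⇒δ>0 {x = x} refl rewrite δ-refl x = s≤s z≤n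

#occ : ∀ {m} → Fin m → List (Fin m) → ℕ
#occ x [] = 0
#occ x (y ∷ Γ) = δ x y + #occ x Γ

#occ-++ : ∀ {m} (x : Fin m) Γ Δ → #occ x (Γ ++ Δ) ≡ #occ x Γ + #occ x Δ
#occ-++ x [] Δ = refl
#occ-++ x (y ∷ Γ) Δ = trans (cong (δ x y +_) (#occ-++ x Γ Δ)) (sym (+-assoc (δ x y) (#occ x Γ) (#occ x Δ)))

#occ-↭ : ∀ {m} (x : Fin m) {Γ Δ} → Γ ↭ Δ → #occ x Γ ≡ #occ x Δ
#occ-↭ x ↭.refl = refl
#occ-↭ x (↭.prep y p) = cong (δ x y +_) (#occ-↭ x p)
#occ-↭ x (↭.swap {Γ} {Δ} y z p) = begin
  δ x y + (δ x z + #occ x Γ) ≡⟨ sym (+-assoc (δ x y) _ _) ⟩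
  (δ x y + δ x z) + #occ x Γ ≡⟨ cong₂ _+_ (+-comm (δ x y) (δ x z)) (#occ-↭ x p) ⟩
  (δ x z + δ x y) + #occ x Δ ≡⟨ +-assoc (δ x z) _ _ ⟩
  δ x z + (δ x y + #occ x Δ) ∎
  where open ≡-Reasoning
#occ-↭ x (↭.trans p q) = trans (#occ-↭ x p) (#occ-↭ x q)

#occ-∈ : ∀ {m} {x : Fin m} {Γ} → x ∈ Γ → 0 < #occ x Γ
#occ-∈ {x = x} {y ∷ Γ} (here x≡y) = ≤-trans (≡⇒δ>0 x≡y) (m≤m+n _ _)
#occ-∈ {x = x} {y ∷ Γ} (there x∈Γ) = ≤-trans (#occ-∈ x∈Γ) (m≤n+m _ (δ x y))

#occ-∉ : ∀ {m} {x : Fin m} {Γ} → x ∉ Γ → #occ x Γ ≡ 0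
#occ-∉ {Γ = []} _ = refl
#occ-∉ {Γ = y ∷ Γ} x∉ = cong₂ _+_ (δ-≢ (x∉ ∘ here)) (#occ-∉ (x∉ ∘ there))

#occ-unique : ∀ {m} {x : Fin m} {Γ} → Unique Γ → x ∈ Γ → #occ x Γ ≡ 1
#occ-unique {x = x} (y∉Γ ∷ _) (here refl) = cong₂ _+_ (δ-refl x) (#occ-∉ λ x∈Γ → All.lookup y∉Γ x∈Γ refl)
#occ-unique {x = x} {y ∷ Γ} (y∉Γ ∷ uΓ) (there x∈Γ) = cong₂ _+_ (δ-≢ {x = x} {y} λ { refl → All.lookup y∉Γ x∈Γ refl }) (#occ-unique uΓ x∈Γ)

unique-∉-rest : ∀ {m} {x : Fin m} A B → Unique (A ++ x ∷ B) → x ∉ A ++ B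
unique-∉-rest {x = x} A B unique x∈ with #occ-∈ x∈
... | occ>0 rewrite suc-injective (trans (cong (_+ #occ x (A ++ B)) (sym (δ-refl x)))
                      (trans (sym (#occ-↭ x (shift x A B))) (#occ-unique unique (∈-++⁺ʳ A (here refl))))) with occ>0
...   | ()

m+n>0⇒m>0⊎n>0 : ∀ m n → 0 < m + n → 0 < m ⊎ 0 < n
m+n>0⇒m>0⊎n>0 (suc m) n _ = inj₁ (s≤s z≤n)
m+n>0⇒m>0⊎n>0 zero n p = inj₂ p

δ+δ>0⇒≡⊎≡ : ∀ {m} {x y z : Fin m} → 0 < δ x y + δ x z → x ≡ y ⊎ x ≡ z
δ+δ>0⇒≡⊎≡ {x = x} {y} {z} p = Data.Sum.map δ>0⇒≡ δ>0⇒≡ (m+n>0⇒m>0⊎n>0 (δ x y) (δ x z) p)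

+≡0 : ∀ m {n} → m + n ≡ 0 → m ≡ 0 × n ≡ 0
+≡0 m m+n≡0 = m+n≡0⇒m≡0 m m+n≡0 , m+n≡0⇒n≡0 m m+n≡0

+≡1 : ∀ m {n} → m + n ≡ 1 → (m ≡ 1 × n ≡ 0) ⊎ (m ≡ 0 × n ≡ 1)
+≡1 zero eq = inj₂ (refl , eq)
+≡1 (suc zero) {zero} eq = inj₁ (refl , refl)

+≡1ˡ : ∀ m {n} → m + n ≡ 1 → 0 < m → m ≡ 1 × n ≡ 0
+≡1ˡ m eq pos with +≡1 m eq
... | inj₁ ok = ok
... | inj₂ (refl , _) with pos
...   | ()

+≡1ʳ : ∀ m {n} → m + n ≡ 1 → 0 < n → m ≡ 0 × n ≡ 1
+≡1ʳ m eq pos with +≡1 m eq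
... | inj₂ ok = ok
... | inj₁ (_ , refl) with pos
...   | ()

+≡0₃ : ∀ a b {c} → (a + b) + c ≡ 0 → a ≡ 0 × b ≡ 0 × c ≡ 0
+≡0₃ a b eq = let (ab , c) = +≡0 (a + b) eq ; (a₀ , b₀) = +≡0 a ab in a₀ , b₀ , c

+≡0₄ : ∀ a b c {d} → (a + b) + (c + d) ≡ 0 → a ≡ 0 × b ≡ 0 × c ≡ 0 × d ≡ 0
+≡0₄ a b c eq = let (a₀ , b₀ , cd) = +≡0₃ a b eq ; (c₀ , d₀) = +≡0 c cd in a₀ , b₀ , c₀ , d₀

∷ʳ-++-↭ : ∀ {A : Set} (X : List A) x Y → (X ∷ʳ x) ++ Y ↭ (X ++ Y) ∷ʳ x
∷ʳ-++-↭ X x Y = begin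
  (X ∷ʳ x) ++ Y ≡⟨ ++-assoc X (x ∷ []) Y ⟩
  X ++ x ∷ Y    ↭⟨ shift x X Y ⟩
  x ∷ X ++ Y    ↭⟨ ∷↭∷ʳ x (X ++ Y) ⟩
  (X ++ Y) ∷ʳ x ∎
  where open ↭.PermutationReasoning

positive-summands≰1 : ∀ d {m n} → 0 < m → 0 < n → d + (m + n) ≤ 1 → ⊥
positive-summands≰1 d {suc m} {suc n} _ _ le with ≤-trans (m≤n+m (suc m + suc n) d) le
... | s≤s le' rewrite +-suc m n with le'
...   | ()

≤-middle : ∀ a b c → b ≤ a + (b + c)
≤-middle a b c = ≤-trans (m≤m+n b c) (m≤n+m _ a)

≤-last : ∀ a b c → c ≤ a + (b + c)
≤-last a b c = ≤-trans (m≤n+m c b) (m≤n+m _ a)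

+≡1-middle : ∀ a b {c} → a + (b + c) ≡ 1 → 0 < b → a ≡ 0 × b ≡ 1 × c ≡ 0
+≡1-middle a b eq pos = let (a₀ , bc) = +≡1ʳ a eq (≤-trans pos (m≤m+n _ _)) ; (b₁ , c₀) = +≡1ˡ b bc pos in a₀ , b₁ , c₀

+≡1-last : ∀ a b {c} → a + (b + c) ≡ 1 → 0 < c → a ≡ 0 × b ≡ 0 × c ≡ 1
+≡1-last a b eq pos = let (a₀ , bc) = +≡1ʳ a eq (≤-trans pos (m≤n+m _ b)) ; (b₀ , c₁) = +≡1ʳ b bc pos in a₀ , b₀ , c₁

+≡1-first₃ : ∀ a b {c} → (a + b) + c ≡ 1 → 0 < a → b ≡ 0 × c ≡ 0
+≡1-first₃ a b eq pos = let (ab , c₀) = +≡1ˡ (a + b) eq (≤-trans pos (m≤m+n _ _)) in proj₂ (+≡1ˡ a ab pos) , c₀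

+≡1-second₃ : ∀ a b {c} → (a + b) + c ≡ 1 → 0 < b → a ≡ 0 × c ≡ 0
+≡1-second₃ a b eq pos = let (ab , c₀) = +≡1ˡ (a + b) eq (≤-trans pos (m≤n+m _ a)) in proj₁ (+≡1ʳ a ab pos) , c₀

+≡1-last₃ : ∀ a b {c} → (a + b) + c ≡ 1 → 0 < c → a ≡ 0 × b ≡ 0 × c ≡ 1
+≡1-last₃ a b eq pos = let (ab , c₁) = +≡1ʳ (a + b) eq pos ; (a₀ , b₀) = +≡0 a ab in a₀ , b₀ , c₁

+≡1-third₄ : ∀ a b c {d} → (a + b) + (c + d) ≡ 1 → 0 < c → a ≡ 0 × b ≡ 0 × c ≡ 1 × d ≡ 0
+≡1-third₄ a b c eq pos =
  let (a₀ , b₀ , cd) = +≡1-last₃ a b eq (≤-trans pos (m≤m+n _ _)) ; (c₁ , d₀) = +≡1ˡ c cd pos in a₀ , b₀ , c₁ , d₀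

+≡1-fourth₄ : ∀ a b c {d} → (a + b) + (c + d) ≡ 1 → 0 < d → a ≡ 0 × b ≡ 0 × c ≡ 0 × d ≡ 1
+≡1-fourth₄ a b c eq pos =
  let (a₀ , b₀ , cd) = +≡1-last₃ a b eq (≤-trans pos (m≤n+m _ c)) ; (c₀ , d₁) = +≡1ʳ c cd pos in a₀ , b₀ , c₀ , d₁

δ≡0⇒≢ : ∀ {m} {x y : Fin m} → δ x y ≡ 0 → y ≢ x
δ≡0⇒≢ {x = x} eq refl with trans (sym (δ-refl x)) eq
... | ()

δ≡1⇒≡ : ∀ {m} {x y : Fin m} → δ x y ≡ 1 → x ≡ y
δ≡1⇒≡ eq = δ>0⇒≡ (subst (0 <_) (sym eq) (s≤s z≤n))

-- Creations and uses of an occurrence in a sequent proof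

module ProofFacts {m : ℕ} (S : ProofStructure m) where

  ≼-trans : ∀ {Θ Δ Γ} {ρ : Proof S Θ} {σ : Proof S Δ} {π : Proof S Γ} →
            _≼_ S ρ σ → _≼_ S σ π → _≼_ S ρ π
  ≼-trans ρ≼σ here = ρ≼σ
  ≼-trans ρ≼σ (there σ≼τ τ◃π) = there (≼-trans ρ≼σ σ≼τ) τ◃π

  ◃⇒≼ : ∀ {Δ Γ} {ρ : Proof S Δ} {π : Proof S Γ} → _◃_ S ρ π → _≼_ S ρ π
  ◃⇒≼ = there here

  ≼-subst : ∀ {Θ Γ Δ} {ρ : Proof S Θ} {π : Proof S Γ} (eq : Γ ≡ Δ) →
            _≼_ S ρ π → _≼_ S ρ (subst (Proof S) eq π)
  ≼-subst refl ρ≼π = ρ≼π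

  createdIn-≼ : ∀ {x Δ Γ} {ρ : Proof S Δ} {π : Proof S Γ} →
                CreatedIn S x ρ → _≼_ S ρ π → CreatedIn S x π
  createdIn-≼ (Θ , τ , τ≼ρ , c) ρ≼π = Θ , τ , ≼-trans τ≼ρ ρ≼π , c

  createdIn-subst : ∀ {x Γ Δ} {π : Proof S Γ} (eq : Γ ≡ Δ) →
                    CreatedIn S x π → CreatedIn S x (subst (Proof S) eq π)
  createdIn-subst refl c = c

  creates⇒createdIn : ∀ {x Γ} {π : Proof S Γ} → Creates S x π → CreatedIn S x π
  creates⇒createdIn c = _ , _ , here , c

  ∈⇒createdIn : ∀ {x Γ} (π : Proof S Γ) → x ∈ Γ → CreatedIn S x π
  ∈⇒createdIn (ax-r _ _) (here refl) = creates⇒createdIn (inj₁ refl)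
  ∈⇒createdIn (ax-r _ _) (there (here refl)) = creates⇒createdIn (inj₂ refl)
  ∈⇒createdIn (⊗-r _ _ _) (here refl) = creates⇒createdIn refl
  ∈⇒createdIn (⊗-r {Γ = Γ} _ π₁ π₂) (there x∈) with ∈-++⁻ Γ x∈
  ... | inj₁ x∈Γ = createdIn-≼ (∈⇒createdIn π₁ (there x∈Γ)) (◃⇒≼ ⊗-l◃)
  ... | inj₂ x∈Δ = createdIn-≼ (∈⇒createdIn π₂ (there x∈Δ)) (◃⇒≼ ⊗-r◃)
  ∈⇒createdIn (⅋-r _ _) (here refl) = creates⇒createdIn refl
  ∈⇒createdIn (⅋-r _ π) (there x∈) = createdIn-≼ (∈⇒createdIn π (there (there x∈))) (◃⇒≼ ⅋◃)
  ∈⇒createdIn (⊗J-r _ _ _ _ _) (here refl) = creates⇒createdIn (inj₁ refl)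
  ∈⇒createdIn (⊗J-r _ _ _ _ _) (there (here refl)) = creates⇒createdIn (inj₂ (inj₂ refl))
  ∈⇒createdIn (⊗J-r _ _ _ _ π) (there (there x∈)) = createdIn-≼ (∈⇒createdIn π (there x∈)) (◃⇒≼ ⊗J◃)
  ∈⇒createdIn (⅋J-r _ _ _ _) (here refl) = creates⇒createdIn refl
  ∈⇒createdIn (⅋J-r _ _ _ π) (there x∈) = createdIn-≼ (∈⇒createdIn π (there (there x∈))) (◃⇒≼ ⅋J◃)
  ∈⇒createdIn (ex-r p π) x∈ = createdIn-≼ (∈⇒createdIn π (∈-resp-↭ (↭-sym p) x∈)) (◃⇒≼ ex◃)

  UsedIn : ∀ {Γ} → Fin m → Proof S Γ → Set
  UsedIn x π = ∃[ Δ ] Σ (Proof S Δ) λ σ → _≼_ S σ π × Uses S x σ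

  CreatedAboveUse : ∀ {Δ} → Fin m → Fin m → Proof S Δ → Set
  CreatedAboveUse x y σ = Uses S y σ × (∃[ Θ ] Σ (Proof S Θ) λ σ' → _◃_ S σ' σ × y ∈ Θ × CreatedIn S x σ')

  AboveUse : ∀ {Γ} → Fin m → Fin m → Proof S Γ → Set
  AboveUse x y π = ∃[ Δ ] Σ (Proof S Δ) λ σ → _≼_ S σ π × CreatedAboveUse x y σ

  #created : ∀ {Γ} → Fin m → Proof S Γ → ℕ
  #created x (ax-r {v} {w} _ _) = δ x v + δ x w
  #created x (⊗-r {v} _ π₁ π₂) = δ x v + (#created x π₁ + #created x π₂)
  #created x (⅋-r {v} _ π) = δ x v + #created x π
  #created x (⊗J-r {v} {j = j} {k} _ _ _ _ π) = δ x v + (δ x j + (δ x k + #created x π))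
  #created x (⅋J-r {v} _ _ _ π) = δ x v + #created x π
  #created x (ex-r _ π) = #created x π

  #used : ∀ {Γ} → Fin m → Proof S Γ → ℕ
  #used x (ax-r _ _) = 0
  #used x (⊗-r {a = a} {b} _ π₁ π₂) = (δ x a + δ x b) + (#used x π₁ + #used x π₂)
  #used x (⅋-r {a = a} {b} _ π) = (δ x a + δ x b) + #used x π
  #used x (⊗J-r {a = a} {j} _ _ _ _ π) = (δ x a + δ x j) + #used x π
  #used x (⅋J-r {k = k} {a} _ _ _ π) = (δ x k + δ x a) + #used x π
  #used x (ex-r _ π) = #used x π

  #created≡#occ+#used : ∀ {Γ} x (π : Proof S Γ) → #created x π ≡ #occ x Γ + #used x π
  #created≡#occ+#used x (ax-r {v} {w} _ _) = solve-∀ (δ x v) (δ x w)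
    where solve-∀ : ∀ a b → a + b ≡ a + (b + 0) + 0
          solve-∀ = RingSolver.solve-∀
  #created≡#occ+#used x (⊗-r {v} {a} {b} {Γ} {Δ} _ π₁ π₂)
    rewrite #created≡#occ+#used x π₁ | #created≡#occ+#used x π₂ | #occ-++ x Γ Δ =
    shuffle (δ x v) (δ x a) (#occ x Γ) (#used x π₁) (δ x b) (#occ x Δ) (#used x π₂)
    where shuffle : ∀ a b c d e f g → a + ((b + c + d) + (e + f + g)) ≡ (a + (c + f)) + ((b + e) + (d + g))
          shuffle = RingSolver.solve-∀
  #created≡#occ+#used x (⅋-r {v} {a} {b} {Γ} _ π) rewrite #created≡#occ+#used x π =
    shuffle (δ x v) (δ x a) (δ x b) (#occ x Γ) (#used x π)
    where shuffle : ∀ a b c d e → a + (b + (c + d) + e) ≡ (a + d) + ((b + c) + e)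
          shuffle = RingSolver.solve-∀
  #created≡#occ+#used x (⊗J-r {v} {a} {j} {k} {Γ} _ _ _ _ π) rewrite #created≡#occ+#used x π =
    shuffle (δ x v) (δ x j) (δ x k) (δ x a) (#occ x Γ) (#used x π)
    where shuffle : ∀ a b c d e f → a + (b + (c + (d + e + f))) ≡ (a + (c + e)) + ((d + b) + f)
          shuffle = RingSolver.solve-∀
  #created≡#occ+#used x (⅋J-r {v} {k} {a} {Γ} _ _ _ π) rewrite #created≡#occ+#used x π =
    shuffle (δ x v) (δ x k) (δ x a) (#occ x Γ) (#used x π)
    where shuffle : ∀ a b c d e → a + (b + (c + d) + e) ≡ (a + d) + ((b + c) + e)
          shuffle = RingSolver.solve-∀
  #created≡#occ+#used x (ex-r p π) rewrite #created≡#occ+#used x π = cong (_+ #used x π) (#occ-↭ x p)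

  #created-subst : ∀ x {Γ Δ} (eq : Γ ≡ Δ) (π : Proof S Γ) → #created x (subst (Proof S) eq π) ≡ #created x π
  #created-subst x refl π = refl

  #created-◃ : ∀ {x Δ Γ} {ρ : Proof S Δ} {π : Proof S Γ} → _◃_ S ρ π → #created x ρ ≤ #created x π
  #created-◃ {x} (⊗-l◃ {v} {π₁ = π₁} {π₂}) = ≤-trans (m≤m+n (#created x π₁) _) (m≤n+m _ (δ x v))
  #created-◃ {x} (⊗-r◃ {v} {π₁ = π₁} {π₂}) = ≤-trans (m≤n+m (#created x π₂) _) (m≤n+m _ (δ x v))
  #created-◃ {x} (⅋◃ {v}) = m≤n+m _ (δ x v)
  #created-◃ {x} (⊗J◃ {v} {j = j} {k} {π = π}) =
    ≤-trans (≤-trans (m≤n+m (#created x π) (δ x k)) (m≤n+m _ (δ x j))) (m≤n+m _ (δ x v))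
  #created-◃ {x} (⅋J◃ {v}) = m≤n+m _ (δ x v)
  #created-◃ ex◃ = ≤-refl

  #used-◃ : ∀ {x Δ Γ} {ρ : Proof S Δ} {π : Proof S Γ} → _◃_ S ρ π → #used x ρ ≤ #used x π
  #used-◃ {x} (⊗-l◃ {a = a} {b} {π₁ = π₁} {π₂}) = ≤-trans (m≤m+n (#used x π₁) (#used x π₂)) (m≤n+m _ (δ x a + δ x b))
  #used-◃ {x} (⊗-r◃ {a = a} {b} {π₁ = π₁} {π₂}) = ≤-trans (m≤n+m (#used x π₂) (#used x π₁)) (m≤n+m _ (δ x a + δ x b))
  #used-◃ {x} (⅋◃ {a = a} {b}) = m≤n+m _ (δ x a + δ x b)
  #used-◃ {x} (⊗J◃ {a = a} {j}) = m≤n+m _ (δ x a + δ x j)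
  #used-◃ {x} (⅋J◃ {k = k} {a}) = m≤n+m _ (δ x k + δ x a)
  #used-◃ ex◃ = ≤-refl

  #created-≼ : ∀ {x Δ Γ} {ρ : Proof S Δ} {π : Proof S Γ} → _≼_ S ρ π → #created x ρ ≤ #created x π
  #created-≼ here = ≤-refl
  #created-≼ (there ρ≼σ σ◃π) = ≤-trans (#created-≼ ρ≼σ) (#created-◃ σ◃π)

  #used-≼ : ∀ {x Δ Γ} {ρ : Proof S Δ} {π : Proof S Γ} → _≼_ S ρ π → #used x ρ ≤ #used x π
  #used-≼ here = ≤-refl
  #used-≼ (there ρ≼σ σ◃π) = ≤-trans (#used-≼ ρ≼σ) (#used-◃ σ◃π)

  creates⇒#created>0 : ∀ {x Γ} (π : Proof S Γ) → Creates S x π → 0 < #created x π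
  creates⇒#created>0 (ax-r _ _) (inj₁ e) = ≤-trans (≡⇒δ>0 e) (m≤m+n _ _)
  creates⇒#created>0 (ax-r _ _) (inj₂ e) = ≤-trans (≡⇒δ>0 e) (m≤n+m _ _)
  creates⇒#created>0 (⊗-r _ _ _) e = ≤-trans (≡⇒δ>0 e) (m≤m+n _ _)
  creates⇒#created>0 (⅋-r _ _) e = ≤-trans (≡⇒δ>0 e) (m≤m+n _ _)
  creates⇒#created>0 (⊗J-r _ _ _ _ _) (inj₁ e) = ≤-trans (≡⇒δ>0 e) (m≤m+n _ _)
  creates⇒#created>0 {x} (⊗J-r {v} _ _ _ _ _) (inj₂ (inj₁ e)) =
    ≤-trans (≤-trans (≡⇒δ>0 e) (m≤m+n _ _)) (m≤n+m _ (δ x v))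
  creates⇒#created>0 {x} (⊗J-r {v} {j = j} _ _ _ _ _) (inj₂ (inj₂ e)) =
    ≤-trans (≤-trans (≤-trans (≡⇒δ>0 e) (m≤m+n _ _)) (m≤n+m _ (δ x j))) (m≤n+m _ (δ x v))
  creates⇒#created>0 (⅋J-r _ _ _ _) e = ≤-trans (≡⇒δ>0 e) (m≤m+n _ _)

  createdIn⇒#created>0 : ∀ {x Γ} (π : Proof S Γ) → CreatedIn S x π → 0 < #created x π
  createdIn⇒#created>0 π (_ , ρ , ρ≼π , c) = ≤-trans (creates⇒#created>0 ρ c) (#created-≼ ρ≼π)

  #created>0⇒createdIn : ∀ {x Γ} (π : Proof S Γ) → 0 < #created x π → CreatedIn S x π
  #created>0⇒createdIn {x} (ax-r {v} {w} _ _) p with m+n>0⇒m>0⊎n>0 (δ x v) (δ x w) p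
  ... | inj₁ q = creates⇒createdIn (inj₁ (δ>0⇒≡ q))
  ... | inj₂ q = creates⇒createdIn (inj₂ (δ>0⇒≡ q))
  #created>0⇒createdIn {x} (⊗-r {v} _ π₁ π₂) p with m+n>0⇒m>0⊎n>0 (δ x v) _ p
  ... | inj₁ q = creates⇒createdIn (δ>0⇒≡ q)
  ... | inj₂ q with m+n>0⇒m>0⊎n>0 (#created x π₁) (#created x π₂) q
  ...   | inj₁ q₁ = createdIn-≼ (#created>0⇒createdIn π₁ q₁) (◃⇒≼ ⊗-l◃)
  ...   | inj₂ q₂ = createdIn-≼ (#created>0⇒createdIn π₂ q₂) (◃⇒≼ ⊗-r◃)
  #created>0⇒createdIn {x} (⅋-r {v} _ π) p with m+n>0⇒m>0⊎n>0 (δ x v) _ p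
  ... | inj₁ q = creates⇒createdIn (δ>0⇒≡ q)
  ... | inj₂ q = createdIn-≼ (#created>0⇒createdIn π q) (◃⇒≼ ⅋◃)
  #created>0⇒createdIn {x} (⊗J-r {v} {j = j} {k} _ _ _ _ π) p with m+n>0⇒m>0⊎n>0 (δ x v) _ p
  ... | inj₁ q = creates⇒createdIn (inj₁ (δ>0⇒≡ q))
  ... | inj₂ q with m+n>0⇒m>0⊎n>0 (δ x j) _ q
  ...   | inj₁ q' = creates⇒createdIn (inj₂ (inj₁ (δ>0⇒≡ q')))
  ...   | inj₂ q' with m+n>0⇒m>0⊎n>0 (δ x k) _ q'
  ...     | inj₁ q'' = creates⇒createdIn (inj₂ (inj₂ (δ>0⇒≡ q'')))
  ...     | inj₂ q'' = createdIn-≼ (#created>0⇒createdIn π q'') (◃⇒≼ ⊗J◃)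
  #created>0⇒createdIn {x} (⅋J-r {v} _ _ _ π) p with m+n>0⇒m>0⊎n>0 (δ x v) _ p
  ... | inj₁ q = creates⇒createdIn (δ>0⇒≡ q)
  ... | inj₂ q = createdIn-≼ (#created>0⇒createdIn π q) (◃⇒≼ ⅋J◃)
  #created>0⇒createdIn (ex-r _ π) p = createdIn-≼ (#created>0⇒createdIn π p) (◃⇒≼ ex◃)

  usedIn⇒#used>0 : ∀ {x Γ} (π : Proof S Γ) → UsedIn x π → 0 < #used x π
  usedIn⇒#used>0 π (_ , σ , σ≼π , u) = ≤-trans (uses⇒#used>0 σ u) (#used-≼ σ≼π)
    where
      uses⇒#used>0 : ∀ {x Γ} (σ : Proof S Γ) → Uses S x σ → 0 < #used x σ
      uses⇒#used>0 (⊗-r _ _ _) (inj₁ e) = ≤-trans (≤-trans (≡⇒δ>0 e) (m≤m+n _ _)) (m≤m+n _ _)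
      uses⇒#used>0 {x} (⊗-r {a = a} _ _ _) (inj₂ e) = ≤-trans (≤-trans (≡⇒δ>0 e) (m≤n+m _ (δ x a))) (m≤m+n _ _)
      uses⇒#used>0 (⅋-r _ _) (inj₁ e) = ≤-trans (≤-trans (≡⇒δ>0 e) (m≤m+n _ _)) (m≤m+n _ _)
      uses⇒#used>0 {x} (⅋-r {a = a} _ _) (inj₂ e) = ≤-trans (≤-trans (≡⇒δ>0 e) (m≤n+m _ (δ x a))) (m≤m+n _ _)
      uses⇒#used>0 (⊗J-r _ _ _ _ _) (inj₁ e) = ≤-trans (≤-trans (≡⇒δ>0 e) (m≤m+n _ _)) (m≤m+n _ _)
      uses⇒#used>0 {x} (⊗J-r {a = a} _ _ _ _ _) (inj₂ e) = ≤-trans (≤-trans (≡⇒δ>0 e) (m≤n+m _ (δ x a))) (m≤m+n _ _)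
      uses⇒#used>0 (⅋J-r _ _ _ _) (inj₁ e) = ≤-trans (≤-trans (≡⇒δ>0 e) (m≤m+n _ _)) (m≤m+n _ _)
      uses⇒#used>0 {x} (⅋J-r {k = k} _ _ _ _) (inj₂ e) = ≤-trans (≤-trans (≡⇒δ>0 e) (m≤n+m _ (δ x k))) (m≤m+n _ _)

  usedIn-◃ : ∀ {x Δ Γ} {ρ : Proof S Δ} {π : Proof S Γ} → UsedIn x ρ → _◃_ S ρ π → UsedIn x π
  usedIn-◃ (_ , σ , σ≼ρ , u) ρ◃π = _ , σ , there σ≼ρ ρ◃π , u

  #used>0⇒usedIn : ∀ {x Γ} (π : Proof S Γ) → 0 < #used x π → UsedIn x π
  #used>0⇒usedIn (ax-r _ _) ()
  #used>0⇒usedIn {x} (⊗-r {a = a} {b} _ π₁ π₂) p with m+n>0⇒m>0⊎n>0 (δ x a + δ x b) _ p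
  ... | inj₁ q = _ , _ , here , δ+δ>0⇒≡⊎≡ q
  ... | inj₂ q with m+n>0⇒m>0⊎n>0 (#used x π₁) (#used x π₂) q
  ...   | inj₁ q₁ = usedIn-◃ (#used>0⇒usedIn π₁ q₁) ⊗-l◃
  ...   | inj₂ q₂ = usedIn-◃ (#used>0⇒usedIn π₂ q₂) ⊗-r◃
  #used>0⇒usedIn {x} (⅋-r {a = a} {b} _ π) p with m+n>0⇒m>0⊎n>0 (δ x a + δ x b) _ p
  ... | inj₁ q = _ , _ , here , δ+δ>0⇒≡⊎≡ q
  ... | inj₂ q = usedIn-◃ (#used>0⇒usedIn π q) ⅋◃
  #used>0⇒usedIn {x} (⊗J-r {a = a} {j} _ _ _ _ π) p with m+n>0⇒m>0⊎n>0 (δ x a + δ x j) _ p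
  ... | inj₁ q = _ , _ , here , δ+δ>0⇒≡⊎≡ q
  ... | inj₂ q = usedIn-◃ (#used>0⇒usedIn π q) ⊗J◃
  #used>0⇒usedIn {x} (⅋J-r {k = k} {a} _ _ _ π) p with m+n>0⇒m>0⊎n>0 (δ x k + δ x a) _ p
  ... | inj₁ q = _ , _ , here , δ+δ>0⇒≡⊎≡ q
  ... | inj₂ q = usedIn-◃ (#used>0⇒usedIn π q) ⅋J◃
  #used>0⇒usedIn (ex-r _ π) p = usedIn-◃ (#used>0⇒usedIn π p) ex◃

-- Sequentializations of MLL proof-structures

size : Formula → ℕ
size (A ⊗ B) = suc (size A + size B)
size (A ⅋ B) = suc (size A + size B)
size _ = 0

premises-of : ∀ {n} {L : Link n} {a b} → L ≡ tens a b ⊎ L ≡ par a b →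
              (premAt L left ≡ just a) × (premAt L right ≡ just b)
premises-of (inj₁ refl) = refl , refl
premises-of (inj₂ refl) = refl , refl

premise-of : ∀ {n} {L : Link n} {s a b u} → premAt L s ≡ just u → L ≡ tens a b ⊎ L ≡ par a b → u ≡ a ⊎ u ≡ b
premise-of {s = left} u◂ L≡ = inj₁ (just-injective (trans (sym u◂) (proj₁ (premises-of L≡))))
premise-of {s = right} u◂ L≡ = inj₂ (just-injective (trans (sym u◂) (proj₂ (premises-of L≡))))

size-premise : ∀ {n} (R : ProofStructure n) {x y s} → premAt (link R y) s ≡ just x →
               size (lab R x) < size (lab R y)
size-premise R {x} {y} {s} p with link R y in eq
size-premise R {s = left} refl | tens a b rewrite tens-lab R _ a b eq = s≤s (m≤m+n _ _)
size-premise R {s = right} refl | tens a b rewrite tens-lab R _ a b eq = s≤s (m≤n+m _ _)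
size-premise R {s = left} refl | par a b rewrite par-lab R _ a b eq = s≤s (m≤m+n _ _)
size-premise R {s = right} refl | par a b rewrite par-lab R _ a b eq = s≤s (m≤n+m _ _)

NoJ⇒NotJAtom : ∀ {A} → NoJ A → NotJAtom A
NoJ⇒NotJAtom noJ = (λ { refl → case noJ of λ () }) , (λ { refl → case noJ of λ () })

⊗⇒NotJAtom : ∀ {A B C} → A ≡ B ⊗ C → NotJAtom A
⊗⇒NotJAtom refl = (λ ()) , (λ ())

⅋⇒NotJAtom : ∀ {A B C} → A ≡ B ⅋ C → NotJAtom A
⅋⇒NotJAtom refl = (λ ()) , (λ ())

module MLLSequentialization {n : ℕ} (R : ProofStructure n) (mll : IsMLL R) where
  open ProofFacts R

  lab≢J : ∀ {v} → lab R v ≢ J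
  lab≢J {v} e with subst NoJ e (mll v)
  ... | ()

  lab≢J⊥ : ∀ {v} → lab R v ≢ J⊥
  lab≢J⊥ {v} e with subst NoJ e (mll v)
  ... | ()

  left≢right : left ≢ right
  left≢right ()

  δ-premises : ∀ {x y s v a b} → premAt (link R y) s ≡ just x →
               premAt (link R v) left ≡ just a → premAt (link R v) right ≡ just b →
               δ x a + δ x b ≡ δ y v
  δ-premises {x} {y} {s} {v} {a} {b} x◂y a◂v b◂v with y ≟ v
  ... | no y≢v = cong₂ _+_ (δ-≢ {x = x} {a} λ { refl → y≢v (proj₁ (premise-once R x y s v left x◂y a◂v)) })
                           (δ-≢ {x = x} {b} λ { refl → y≢v (proj₁ (premise-once R x y s v right x◂y b◂v)) })
  δ-premises {x} {s = left} {b = b} x◂v a◂v b◂v | yes refl with just-injective (trans (sym x◂v) a◂v)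
  ... | refl = cong₂ _+_ (δ-refl x) (δ-≢ {x = x} {b} λ { refl → left≢right (proj₂ (premise-once R x _ left _ right a◂v b◂v)) })
  δ-premises {x} {s = right} {a = a} x◂v a◂v b◂v | yes refl with just-injective (trans (sym x◂v) b◂v)
  ... | refl = cong₂ _+_ (δ-≢ {x = x} {a} λ { refl → left≢right (proj₂ (premise-once R x _ left _ right a◂v b◂v)) }) (δ-refl x)

  δ-premises-conclusion : ∀ {x v a b} → IsConclusion R x →
               premAt (link R v) left ≡ just a → premAt (link R v) right ≡ just b → δ x a + δ x b ≡ 0
  δ-premises-conclusion {x} {v} {a} {b} c a◂v b◂v =
    cong₂ _+_ (δ-≢ {x = x} {a} λ { refl → c v left a◂v }) (δ-≢ {x = x} {b} λ { refl → c v right b◂v })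

  #used-premise : ∀ {Γ x y s} → premAt (link R y) s ≡ just x → (π : Proof R Γ) → #used x π ≡ #created y π
  #used-premise {y = y} x◂y (ax-r {v} {w} e _) =
    sym (cong₂ _+_ (δ-≢ {x = y} {v} λ { refl → axiom-premise e }) (δ-≢ {x = y} {w} λ { refl → axiom-premise (ax-sym R v w e) }))
    where axiom-premise : ∀ {u} → link R y ≡ ax u → ⊥
          axiom-premise e with trans (sym (cong (λ L → premAt L _) e)) x◂y
          ... | ()
  #used-premise x◂y (⊗-r e π₁ π₂) = let (a◂v , b◂v) = premises-of (inj₁ e) in
    cong₂ _+_ (δ-premises x◂y a◂v b◂v) (cong₂ _+_ (#used-premise x◂y π₁) (#used-premise x◂y π₂))
  #used-premise x◂y (⅋-r e π) = let (a◂v , b◂v) = premises-of (inj₂ e) in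
    cong₂ _+_ (δ-premises x◂y a◂v b◂v) (#used-premise x◂y π)
  #used-premise x◂y (⊗J-r _ _ isJ _ _) = ⊥-elim (lab≢J isJ)
  #used-premise x◂y (⅋J-r _ isJ⊥ _ _) = ⊥-elim (lab≢J⊥ isJ⊥)
  #used-premise x◂y (ex-r _ π) = #used-premise x◂y π

  #used-conclusion : ∀ {Γ x} → IsConclusion R x → (π : Proof R Γ) → #used x π ≡ 0
  #used-conclusion c (ax-r _ _) = refl
  #used-conclusion c (⊗-r e π₁ π₂) = let (a◂v , b◂v) = premises-of (inj₁ e) in
    cong₂ _+_ (δ-premises-conclusion c a◂v b◂v) (cong₂ _+_ (#used-conclusion c π₁) (#used-conclusion c π₂))
  #used-conclusion c (⅋-r e π) = let (a◂v , b◂v) = premises-of (inj₂ e) in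
    cong₂ _+_ (δ-premises-conclusion c a◂v b◂v) (#used-conclusion c π)
  #used-conclusion c (⊗J-r _ _ isJ _ _) = ⊥-elim (lab≢J isJ)
  #used-conclusion c (⅋J-r _ isJ⊥ _ _) = ⊥-elim (lab≢J⊥ isJ⊥)
  #used-conclusion c (ex-r _ π) = #used-conclusion c π

  IsPremise : Fin n → Set
  IsPremise x = ∃[ y ] ∃[ s ] premAt (link R y) s ≡ just x

  premise-or-conclusion : ∀ x → IsPremise x ⊎ IsConclusion R x
  premise-or-conclusion x with any? (λ y → ≡-dec _≟_ (premAt (link R y) left) (just x) ⊎-dec ≡-dec _≟_ (premAt (link R y) right) (just x))
  ... | yes (y , inj₁ p) = inj₁ (y , left , p)
  ... | yes (y , inj₂ p) = inj₁ (y , right , p)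
  ... | no ¬p = inj₂ λ { y left p → ¬p (y , inj₁ p) ; y right p → ¬p (y , inj₂ p) }

  depth : Fin n → ℕ
  depth x = max 0 (map (size ∘ lab R) (allFin n)) ∸ size (lab R x)

  depth-premise : ∀ {x y s} → premAt (link R y) s ≡ just x → depth y < depth x
  depth-premise {y = y} p =
    ∸-monoʳ-< (size-premise R p) (All.lookup (xs≤max 0 (map (size ∘ lab R) (allFin n))) (∈-map⁺ (size ∘ lab R) (∈-allFin y)))

  created-once : ∀ {Γ} → ConclusionList R Γ → (π : Proof R Γ) → ∀ x → #created x π ≡ 1
  created-once {Γ} (unique , ∈⇔conclusion) π = WF.All.wfRec (On.wellFounded depth <-wellFounded) _ (λ x → #created x π ≡ 1) step
    where
      open ≡-Reasoning
      step : ∀ x → (∀ {y} → depth y < depth x → #created y π ≡ 1) → #created x π ≡ 1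
      step x ih with premise-or-conclusion x
      ... | inj₂ c = begin
        #created x π ≡⟨ #created≡#occ+#used x π ⟩
        #occ x Γ + #used x π ≡⟨ cong₂ _+_ (#occ-unique unique (Equivalence.from (∈⇔conclusion x) c)) (#used-conclusion c π) ⟩
        1 ∎
      ... | inj₁ (y , s , x◂y) = begin
        #created x π ≡⟨ #created≡#occ+#used x π ⟩
        #occ x Γ + #used x π ≡⟨ cong₂ _+_ (#occ-∉ λ x∈Γ → Equivalence.to (∈⇔conclusion x) x∈Γ y s x◂y) (#used-premise x◂y π) ⟩
        #created y π ≡⟨ ih (depth-premise x◂y) ⟩
        1 ∎

-- The vertices and links of J_{F→F'}(R)

data GadgetVertex (n : ℕ) : Fin (n + 4) → Set where
  is-old : (x : Fin n) → GadgetVertex n (x ↑ˡ 4)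
  is-new : (j : Fin 4) → GadgetVertex n (n ↑ʳ j)

gadgetVertex : ∀ {n} (i : Fin (n + 4)) → GadgetVertex n i
gadgetVertex {n} i with splitAt n i in eq
... | inj₁ x = subst (GadgetVertex n) (splitAt⁻¹-↑ˡ eq) (is-old x)
... | inj₂ j = subst (GadgetVertex n) (splitAt⁻¹-↑ʳ eq) (is-new j)

old≢new : ∀ {n} (x : Fin n) (j : Fin 4) → x ↑ˡ 4 ≢ n ↑ʳ j
old≢new {n} x j eq with trans (sym (splitAt-↑ˡ n x 4)) (trans (cong (splitAt n) eq) (splitAt-↑ʳ n 4 j))
... | ()

caseVertex : ∀ {n} {A : Set} → (Fin n → A) → (Fin 4 → A) → Fin (n + 4) → A
caseVertex {n} f g i = [ f , g ]′ (splitAt n i)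

caseVertex-old : ∀ {n} {A : Set} (f : Fin n → A) (g : Fin 4 → A) x → caseVertex f g (x ↑ˡ 4) ≡ f x
caseVertex-old {n} f g x = cong [ f , g ]′ (splitAt-↑ˡ n x 4)

caseVertex-new : ∀ {n} {A : Set} (f : Fin n → A) (g : Fin 4 → A) j → caseVertex f g (n ↑ʳ j) ≡ g j
caseVertex-new {n} f g j = cong [ f , g ]′ (splitAt-↑ʳ n 4 j)

module GadgetVertices {n : ℕ} (F F' : Fin n) (F≢F' : F ≢ F') where
  open Gadget F F' public

  old-injective : ∀ {x y} → old x ≡ old y → x ≡ y
  old-injective = ↑ˡ-injective 4 _ _

  new≢new : ∀ {i j : Fin 4} → i ≢ j → n ↑ʳ i ≢ n ↑ʳ j
  new≢new i≢j e = i≢j (↑ʳ-injective n _ _ e)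

  tv≢pv : tv ≢ pv
  tv≢pv = new≢new λ ()
  jv≢j⊥v : jv ≢ j⊥v
  jv≢j⊥v = new≢new λ ()
  jv≢pv : jv ≢ pv
  jv≢pv = new≢new λ ()
  j⊥v≢pv : j⊥v ≢ pv
  j⊥v≢pv = new≢new λ ()

  data Renamed (x : Fin n) (r : Fin (n + 4)) : Set where
    F↦tv   : x ≡ F → r ≡ tv → Renamed x r
    F'↦pv  : x ≡ F' → r ≡ pv → Renamed x r
    old↦old : x ≢ F → x ≢ F' → r ≡ old x → Renamed x r

  renamed : ∀ x → Renamed x (re x)
  renamed x = by-cases (x ≟ F) (x ≟ F')
    where
      by-cases : (x≟F : Dec (x ≡ F)) (x≟F' : Dec (x ≡ F')) →
                 Renamed x (if does x≟F then tv else (if does x≟F' then pv else old x))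
      by-cases (yes x≡F) _ = F↦tv x≡F refl
      by-cases (no x≢F) (yes x≡F') = F'↦pv x≡F' refl
      by-cases (no x≢F) (no x≢F') = old↦old x≢F x≢F' refl

  re-F : re F ≡ tv
  re-F with renamed F
  ... | F↦tv _ r≡tv = r≡tv
  ... | F'↦pv F≡F' _ = ⊥-elim (F≢F' F≡F')
  ... | old↦old F≢F _ _ = ⊥-elim (F≢F refl)

  re-F' : re F' ≡ pv
  re-F' with renamed F'
  ... | F↦tv F'≡F _ = ⊥-elim (F≢F' (sym F'≡F))
  ... | F'↦pv _ r≡pv = r≡pv
  ... | old↦old _ F'≢F' _ = ⊥-elim (F'≢F' refl)

  re-injective : ∀ {x y} → re x ≡ re y → x ≡ y
  re-injective {x} {y} e with renamed x | renamed y
  ... | F↦tv x≡F _ | F↦tv y≡F _ = trans x≡F (sym y≡F)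
  ... | F↦tv _ a | F'↦pv _ b = ⊥-elim (tv≢pv (trans (sym a) (trans e b)))
  ... | F↦tv _ a | old↦old _ _ b = ⊥-elim (old≢new y _ (sym (trans (sym a) (trans e b))))
  ... | F'↦pv _ a | F↦tv _ b = ⊥-elim (tv≢pv (sym (trans (sym a) (trans e b))))
  ... | F'↦pv x≡F' _ | F'↦pv y≡F' _ = trans x≡F' (sym y≡F')
  ... | F'↦pv _ a | old↦old _ _ b = ⊥-elim (old≢new y _ (sym (trans (sym a) (trans e b))))
  ... | old↦old _ _ a | F↦tv _ b = ⊥-elim (old≢new x _ (trans (sym a) (trans e b)))
  ... | old↦old _ _ a | F'↦pv _ b = ⊥-elim (old≢new x _ (trans (sym a) (trans e b)))
  ... | old↦old _ _ a | old↦old _ _ b = old-injective (trans (sym a) (trans e b))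

  re≢jv : ∀ x → re x ≢ jv
  re≢jv x e with renamed x
  ... | F↦tv _ a = new≢new (λ ()) (trans (sym a) e)
  ... | F'↦pv _ a = new≢new (λ ()) (trans (sym a) e)
  ... | old↦old _ _ a = old≢new x _ (trans (sym a) e)

  re≢j⊥v : ∀ x → re x ≢ j⊥v
  re≢j⊥v x e with renamed x
  ... | F↦tv _ a = new≢new (λ ()) (trans (sym a) e)
  ... | F'↦pv _ a = new≢new (λ ()) (trans (sym a) e)
  ... | old↦old _ _ a = old≢new x _ (trans (sym a) e)

  re≢old : ∀ x {y} → y ≡ F ⊎ y ≡ F' → re x ≢ old y
  re≢old x {y} _ e with renamed x
  ... | F↦tv _ a = old≢new y _ (sym (trans (sym a) e))
  ... | F'↦pv _ a = old≢new y _ (sym (trans (sym a) e))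
  re≢old x (inj₁ refl) e | old↦old x≢F _ a = x≢F (old-injective (trans (sym a) e))
  re≢old x (inj₂ refl) e | old↦old _ x≢F' a = x≢F' (old-injective (trans (sym a) e))

  premAt-relink : ∀ (L : Link n) s → premAt (relink L) s ≡ Maybe.map re (premAt L s)
  premAt-relink (ax _) s = refl
  premAt-relink (tens a b) left = refl
  premAt-relink (tens a b) right = refl
  premAt-relink (par a b) left = refl
  premAt-relink (par a b) right = refl

module GraftedLinks {n : ℕ} (R : ProofStructure n) (F F' : Fin n) (F≢F' : F ≢ F')
                    (lk : Fin (n + 4) → Link (n + 4))
                    (link-old : ∀ v → lk (v ↑ˡ 4) ≡ Gadget.relink F F' (link R v))
                    (link-j : lk (n ↑ʳ zero) ≡ ax (n ↑ʳ suc zero))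
                    (link-j⊥ : lk (n ↑ʳ suc zero) ≡ ax (n ↑ʳ zero))
                    (link-t : lk (n ↑ʳ suc (suc zero)) ≡ tens (F ↑ˡ 4) (n ↑ʳ zero))
                    (link-p : lk (n ↑ʳ suc (suc (suc zero))) ≡ par (n ↑ʳ suc zero) (F' ↑ˡ 4)) where
  open GadgetVertices F F' F≢F'

  data AxiomLink : Fin (n + 4) → Fin (n + 4) → Set where
    old-axiom : ∀ {x y} → link R x ≡ ax y → AxiomLink (old x) (old y)
    j-axiom   : AxiomLink jv j⊥v
    j⊥-axiom  : AxiomLink j⊥v jv

  data TensorLink : Fin (n + 4) → Fin (n + 4) → Fin (n + 4) → Set where
    old-tensor    : ∀ {x a b} → link R x ≡ tens a b → TensorLink (old x) (re a) (re b)
    gadget-tensor : TensorLink tv (old F) jv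

  data ParLink : Fin (n + 4) → Fin (n + 4) → Fin (n + 4) → Set where
    old-par    : ∀ {x a b} → link R x ≡ par a b → ParLink (old x) (re a) (re b)
    gadget-par : ParLink pv j⊥v (old F')

  axiom-link : ∀ {v w} → lk v ≡ ax w → AxiomLink v w
  axiom-link {v} e with gadgetVertex v
  ... | is-old x = relinked (link R x) refl (trans (sym (link-old x)) e)
    where relinked : ∀ {w} L → link R x ≡ L → relink L ≡ ax w → AxiomLink (old x) w
          relinked (ax y) eq refl = old-axiom eq
  ... | is-new zero with trans (sym link-j) e
  ...   | refl = j-axiom
  axiom-link e | is-new (suc zero) with trans (sym link-j⊥) e
  ...   | refl = j⊥-axiom
  axiom-link e | is-new (suc (suc zero)) with trans (sym link-t) e
  ...   | ()
  axiom-link e | is-new (suc (suc (suc zero))) with trans (sym link-p) e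
  ...   | ()

  tensor-link : ∀ {v a b} → lk v ≡ tens a b → TensorLink v a b
  tensor-link {v} e with gadgetVertex v
  ... | is-old x = relinked (link R x) refl (trans (sym (link-old x)) e)
    where relinked : ∀ {a b} L → link R x ≡ L → relink L ≡ tens a b → TensorLink (old x) a b
          relinked (tens a b) eq refl = old-tensor eq
  ... | is-new zero with trans (sym link-j) e
  ...   | ()
  tensor-link e | is-new (suc zero) with trans (sym link-j⊥) e
  ...   | ()
  tensor-link e | is-new (suc (suc zero)) with trans (sym link-t) e
  ...   | refl = gadget-tensor
  tensor-link e | is-new (suc (suc (suc zero))) with trans (sym link-p) e
  ...   | ()

  par-link : ∀ {v a b} → lk v ≡ par a b → ParLink v a b
  par-link {v} e with gadgetVertex v
  ... | is-old x = relinked (link R x) refl (trans (sym (link-old x)) e)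
    where relinked : ∀ {a b} L → link R x ≡ L → relink L ≡ par a b → ParLink (old x) a b
          relinked (par a b) eq refl = old-par eq
  ... | is-new zero with trans (sym link-j) e
  ...   | ()
  par-link e | is-new (suc zero) with trans (sym link-j⊥) e
  ...   | ()
  par-link e | is-new (suc (suc zero)) with trans (sym link-t) e
  ...   | ()
  par-link e | is-new (suc (suc (suc zero))) with trans (sym link-p) e
  ...   | refl = gadget-par

  data PremiseCase (u : Fin (n + 4)) : Fin (n + 4) → Side → Set where
    old-premise : ∀ {w s x} → premAt (link R w) s ≡ just x → u ≡ re x → PremiseCase u (old w) s
    t-left      : u ≡ old F → PremiseCase u tv left
    t-right     : u ≡ jv → PremiseCase u tv right
    p-left      : u ≡ j⊥v → PremiseCase u pv left
    p-right     : u ≡ old F' → PremiseCase u pv right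

  premise-old : ∀ {w s x} → premAt (link R w) s ≡ just x → premAt (lk (old w)) s ≡ just (re x)
  premise-old {w} {s} {x} p = begin
    premAt (lk (old w)) s ≡⟨ cong (λ L → premAt L s) (link-old w) ⟩
    premAt (relink (link R w)) s ≡⟨ premAt-relink (link R w) s ⟩
    Maybe.map re (premAt (link R w) s) ≡⟨ cong (Maybe.map re) p ⟩
    just (re x) ∎
    where open ≡-Reasoning

  premise-case : ∀ {v s u} → premAt (lk v) s ≡ just u → PremiseCase u v s
  premise-case {v} {s} {u} p with gadgetVertex v
  ... | is-old w = from-relink (premAt (link R w) s) refl (trans (sym (premAt-relink (link R w) s)) (trans (cong (λ L → premAt L s) (sym (link-old w))) p))
    where from-relink : ∀ m → premAt (link R w) s ≡ m → Maybe.map re m ≡ just u → PremiseCase u (old w) s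
          from-relink (just x) eq e = old-premise eq (sym (just-injective e))
  ... | is-new zero with trans (cong (λ L → premAt L s) (sym link-j)) p
  ...   | ()
  premise-case {s = s} p | is-new (suc zero) with trans (cong (λ L → premAt L s) (sym link-j⊥)) p
  ...   | ()
  premise-case {s = left} p | is-new (suc (suc zero)) = t-left (sym (just-injective (trans (cong (λ L → premAt L left) (sym link-t)) p)))
  premise-case {s = right} p | is-new (suc (suc zero)) = t-right (sym (just-injective (trans (cong (λ L → premAt L right) (sym link-t)) p)))
  premise-case {s = left} p | is-new (suc (suc (suc zero))) = p-left (sym (just-injective (trans (cong (λ L → premAt L left) (sym link-p)) p)))
  premise-case {s = right} p | is-new (suc (suc (suc zero))) = p-right (sym (just-injective (trans (cong (λ L → premAt L right) (sym link-p)) p)))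

  premise-case-unique : ∀ {u v s v' s'} → PremiseCase u v s → PremiseCase u v' s' → (v ≡ v') × (s ≡ s')
  premise-case-unique (old-premise {x = x} p a) (old-premise {x = x'} p' b) with re-injective {x} {x'} (trans (sym a) b)
  ... | refl with premise-once R _ _ _ _ _ p p'
  ...   | refl , refl = refl , refl
  premise-case-unique (old-premise {x = x} _ a) (t-left b) = ⊥-elim (re≢old x (inj₁ refl) (trans (sym a) b))
  premise-case-unique (old-premise {x = x} _ a) (t-right b) = ⊥-elim (re≢jv x (trans (sym a) b))
  premise-case-unique (old-premise {x = x} _ a) (p-left b) = ⊥-elim (re≢j⊥v x (trans (sym a) b))
  premise-case-unique (old-premise {x = x} _ a) (p-right b) = ⊥-elim (re≢old x (inj₂ refl) (trans (sym a) b))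
  premise-case-unique (t-left a) (old-premise {x = x} _ b) = ⊥-elim (re≢old x (inj₁ refl) (trans (sym b) a))
  premise-case-unique (t-right a) (old-premise {x = x} _ b) = ⊥-elim (re≢jv x (trans (sym b) a))
  premise-case-unique (p-left a) (old-premise {x = x} _ b) = ⊥-elim (re≢j⊥v x (trans (sym b) a))
  premise-case-unique (p-right a) (old-premise {x = x} _ b) = ⊥-elim (re≢old x (inj₂ refl) (trans (sym b) a))
  premise-case-unique (t-left _) (t-left _) = refl , refl
  premise-case-unique (t-left a) (t-right b) = ⊥-elim (old≢new F _ (trans (sym a) b))
  premise-case-unique (t-left a) (p-left b) = ⊥-elim (old≢new F _ (trans (sym a) b))
  premise-case-unique (t-left a) (p-right b) = ⊥-elim (F≢F' (old-injective (trans (sym a) b)))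
  premise-case-unique (t-right a) (t-left b) = ⊥-elim (old≢new F _ (trans (sym b) a))
  premise-case-unique (t-right _) (t-right _) = refl , refl
  premise-case-unique (t-right a) (p-left b) = ⊥-elim (jv≢j⊥v (trans (sym a) b))
  premise-case-unique (t-right a) (p-right b) = ⊥-elim (old≢new F' _ (trans (sym b) a))
  premise-case-unique (p-left a) (t-left b) = ⊥-elim (old≢new F _ (trans (sym b) a))
  premise-case-unique (p-left a) (t-right b) = ⊥-elim (jv≢j⊥v (trans (sym b) a))
  premise-case-unique (p-left _) (p-left _) = refl , refl
  premise-case-unique (p-left a) (p-right b) = ⊥-elim (old≢new F' _ (trans (sym b) a))
  premise-case-unique (p-right a) (t-left b) = ⊥-elim (F≢F' (old-injective (trans (sym b) a)))
  premise-case-unique (p-right a) (t-right b) = ⊥-elim (old≢new F' _ (trans (sym a) b))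
  premise-case-unique (p-right a) (p-left b) = ⊥-elim (old≢new F' _ (trans (sym a) b))
  premise-case-unique (p-right _) (p-right _) = refl , refl

  premise-once-grafted : ∀ u v s v' s' → premAt (lk v) s ≡ just u → premAt (lk v') s' ≡ just u → (v ≡ v') × (s ≡ s')
  premise-once-grafted _ _ _ _ _ p q = premise-case-unique (premise-case p) (premise-case q)

  IsConclusionGrafted : Fin (n + 4) → Set
  IsConclusionGrafted v = ∀ w s → premAt (lk w) s ≢ just v

  conclusion-re : ∀ {x} → IsConclusion R x → IsConclusionGrafted (re x)
  conclusion-re {x} c w s p with premise-case p
  ... | old-premise {w = w'} q e = c w' s (subst (λ y → premAt (link R w') s ≡ just y) (re-injective (sym e)) q)
  ... | t-left e = re≢old x (inj₁ refl) e
  ... | t-right e = re≢jv x e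
  ... | p-left e = re≢j⊥v x e
  ... | p-right e = re≢old x (inj₂ refl) e

  conclusion-re⁻ : ∀ {x} → IsConclusionGrafted (re x) → IsConclusion R x
  conclusion-re⁻ c w s p = c (old w) s (premise-old p)

  conclusion-renamed : ∀ {v} → IsConclusionGrafted v → ∃[ x ] v ≡ re x
  conclusion-renamed {v} c with gadgetVertex v
  ... | is-old x with renamed x
  ...   | F↦tv refl _ = ⊥-elim (c tv left (cong (λ L → premAt L left) link-t))
  ...   | F'↦pv refl _ = ⊥-elim (c pv right (cong (λ L → premAt L right) link-p))
  ...   | old↦old _ _ e = x , sym e
  conclusion-renamed c | is-new zero = ⊥-elim (c tv right (cong (λ L → premAt L right) link-t))
  conclusion-renamed c | is-new (suc zero) = ⊥-elim (c pv left (cong (λ L → premAt L left) link-p))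
  conclusion-renamed c | is-new (suc (suc zero)) = F , sym re-F
  conclusion-renamed c | is-new (suc (suc (suc zero))) = F' , sym re-F'

-- Existence of J_{F→F'}(R)

module Construction {n : ℕ} (R : ProofStructure n) (F F' : Fin n) (F≢F' : F ≢ F') where
  open GadgetVertices F F' F≢F'

  gadgetLinks : Fin 4 → Link (n + 4)
  gadgetLinks zero = ax j⊥v
  gadgetLinks (suc zero) = ax jv
  gadgetLinks (suc (suc zero)) = tens (old F) jv
  gadgetLinks (suc (suc (suc zero))) = par j⊥v (old F')

  linkS : Fin (n + 4) → Link (n + 4)
  linkS = caseVertex (relink ∘ link R) gadgetLinks

  linkS-old : ∀ x → linkS (old x) ≡ relink (link R x)
  linkS-old = caseVertex-old (relink ∘ link R) gadgetLinks

  linkS-new : ∀ j → linkS (n ↑ʳ j) ≡ gadgetLinks j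
  linkS-new = caseVertex-new (relink ∘ link R) gadgetLinks

  open GraftedLinks R F F' F≢F' linkS linkS-old (linkS-new _) (linkS-new _) (linkS-new _) (linkS-new _)

  newLabels : (Fin n → Formula) → Fin 4 → Formula
  newLabels f zero = J
  newLabels f (suc zero) = J⊥
  newLabels f (suc (suc zero)) = f F ⊗ J
  newLabels f (suc (suc (suc zero))) = J⊥ ⅋ f F'

  gadgetLabels : (Fin n → Formula) → Fin (n + 4) → Formula
  gadgetLabels f = caseVertex f (newLabels f)

  gadgetLabels-re : ∀ (f g : Fin n → Formula) x → f x ≡ g x → gadgetLabels f (re x) ≡ gadgetLabels g (re x)
  gadgetLabels-re f g x fx≡gx with renamed x
  ... | F↦tv refl e rewrite e =
    trans (caseVertex-new f (newLabels f) _) (trans (cong (_⊗ J) fx≡gx) (sym (caseVertex-new g (newLabels g) _)))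
  ... | F'↦pv refl e rewrite e =
    trans (caseVertex-new f (newLabels f) _) (trans (cong (J⊥ ⅋_) fx≡gx) (sym (caseVertex-new g (newLabels g) _)))
  ... | old↦old _ _ e rewrite e =
    trans (caseVertex-old f (newLabels f) x) (trans fx≡gx (sym (caseVertex-old g (newLabels g) x)))

  sizeR : Fin n → ℕ
  sizeR v = size (lab R v)

  -- labelWithin k gives the type in J_{F→F'}(R) of every vertex whose type in R has size < k.
  labelWithin : ℕ → Fin n → Formula
  relabel : ℕ → Fin n → Link n → Formula
  labelWithin zero v = lab R v
  labelWithin (suc k) v = relabel k v (link R v)
  relabel k v (ax _) = lab R v
  relabel k v (tens a b) = gadgetLabels (labelWithin k) (re a) ⊗ gadgetLabels (labelWithin k) (re b)
  relabel k v (par a b) = gadgetLabels (labelWithin k) (re a) ⅋ gadgetLabels (labelWithin k) (re b)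

  labelWithin-stable : ∀ k k' v → sizeR v < k → sizeR v < k' → labelWithin k v ≡ labelWithin k' v
  labelWithin-stable (suc k) (suc k') v (s≤s v<k) (s≤s v<k') = by-link (link R v) refl
    where
      premise-stable : ∀ {x s} → premAt (link R v) s ≡ just x →
                       gadgetLabels (labelWithin k) (re x) ≡ gadgetLabels (labelWithin k') (re x)
      premise-stable {x} p =
        gadgetLabels-re _ _ x (labelWithin-stable k k' x (≤-trans (size-premise R p) v<k) (≤-trans (size-premise R p) v<k'))
      by-link : ∀ L → link R v ≡ L → relabel k v L ≡ relabel k' v L
      by-link (ax _) _ = refl
      by-link (tens a b) eq = cong₂ _⊗_ (premise-stable (premises-of (inj₁ eq) .proj₁)) (premise-stable (premises-of (inj₁ eq) .proj₂))
      by-link (par a b) eq = cong₂ _⅋_ (premise-stable (premises-of (inj₂ eq) .proj₁)) (premise-stable (premises-of (inj₂ eq) .proj₂))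

  label : Fin n → Formula
  label v = labelWithin (suc (sizeR v)) v

  labS : Fin (n + 4) → Formula
  labS = gadgetLabels label

  labS-old : ∀ x → labS (old x) ≡ label x
  labS-old = caseVertex-old label (newLabels label)

  labS-new : ∀ j → labS (n ↑ʳ j) ≡ newLabels label j
  labS-new = caseVertex-new label (newLabels label)

  label-axiom : ∀ {v w} → link R v ≡ ax w → label v ≡ lab R v
  label-axiom {v} eq = cong (relabel (sizeR v) v) eq

  label-premise : ∀ {v s x} → premAt (link R v) s ≡ just x → gadgetLabels (labelWithin (sizeR v)) (re x) ≡ labS (re x)
  label-premise {x = x} p = gadgetLabels-re _ _ x (labelWithin-stable _ _ x (size-premise R p) ≤-refl)

  S : ProofStructure (n + 4)
  lab S = labS
  link S = linkS
  ax-sym S v w e with axiom-link e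
  ... | old-axiom {x} {y} eq = trans (linkS-old y) (cong relink (ax-sym R x y eq))
  ... | j-axiom = linkS-new _
  ... | j⊥-axiom = linkS-new _
  ax-irr S v w e with axiom-link e
  ... | old-axiom {x} {y} eq = λ x≡y → ax-irr R x y eq (old-injective x≡y)
  ... | j-axiom = jv≢j⊥v
  ... | j⊥-axiom = jv≢j⊥v ∘ sym
  ax-dual S v w e with axiom-link e
  ... | old-axiom {x} {y} eq = begin
    labS (old y) ≡⟨ trans (labS-old y) (label-axiom (ax-sym R x y eq)) ⟩
    lab R y ≡⟨ ax-dual R x y eq ⟩
    dual (lab R x) ≡⟨ cong dual (sym (trans (labS-old x) (label-axiom eq))) ⟩
    dual (labS (old x)) ∎
    where open ≡-Reasoning
  ... | j-axiom rewrite labS-new zero | labS-new (suc zero) = refl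
  ... | j⊥-axiom rewrite labS-new zero | labS-new (suc zero) = refl
  tens-lab S v a b e with tensor-link e
  ... | old-tensor {x} eq = trans (labS-old x) (trans (cong (relabel (sizeR x) x) eq)
          (cong₂ _⊗_ (label-premise (premises-of (inj₁ eq) .proj₁)) (label-premise (premises-of (inj₁ eq) .proj₂))))
  ... | gadget-tensor rewrite labS-new (suc (suc zero)) | labS-old F | labS-new zero = refl
  par-lab S v a b e with par-link e
  ... | old-par {x} eq = trans (labS-old x) (trans (cong (relabel (sizeR x) x) eq)
          (cong₂ _⅋_ (label-premise (premises-of (inj₂ eq) .proj₁)) (label-premise (premises-of (inj₂ eq) .proj₂))))
  ... | gadget-par rewrite labS-new (suc (suc (suc zero))) | labS-new (suc zero) | labS-old F' = refl
  premise-once S = premise-once-grafted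

  S-graft : JGraft R F F' S
  S-graft = record
    { link-old = linkS-old ; link-j = linkS-new _ ; link-j⊥ = linkS-new _ ; link-t = linkS-new _ ; link-p = linkS-new _
    ; lab-j = labS-new zero
    ; lab-ax = λ v w eq → trans (labS-old v) (label-axiom eq) }

module Grafted {n : ℕ} (R : ProofStructure n) (mll : IsMLL R) (F F' : Fin n) (F≢F' : F ≢ F')
               (S : ProofStructure (n + 4)) (G : JGraft R F F' S) where
  open GadgetVertices F F' F≢F'
  open Gadget.IsJGraft G
  open GraftedLinks R F F' F≢F' (link S) link-old link-j link-j⊥ link-t link-p
  open MLLSequentialization R mll
  module ᴿ = ProofFacts R
  module ˢ = ProofFacts S

  lab-j⊥ : lab S j⊥v ≡ J⊥
  lab-j⊥ = trans (ax-dual S jv j⊥v link-j) (cong dual lab-j)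

  notJ-old : ∀ x → NotJAtom (lab S (old x))
  notJ-old x with link R x in eq
  ... | ax w = NoJ⇒NotJAtom (subst NoJ (sym (lab-ax x w eq)) (mll x))
  ... | tens a b = ⊗⇒NotJAtom (tens-lab S (old x) _ _ (trans (link-old x) (cong relink eq)))
  ... | par a b = ⅋⇒NotJAtom (par-lab S (old x) _ _ (trans (link-old x) (cong relink eq)))

  -- Sequentializations of R with F above F' lift to J_{F→F'}(R)

  -- F' keeps its old vertex in translated sequents until ⅋_J⊥ turns it into J⊥ ⅋ F'.
  re⊗ : Fin n → Fin (n + 4)
  re⊗ x = if does (x ≟ F') then old F' else re x

  re⊗-F' : re⊗ F' ≡ old F'
  re⊗-F' with F' ≟ F'
  ... | yes _ = refl
  ... | no F'≢F' = ⊥-elim (F'≢F' refl)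

  re⊗≡re : ∀ {x} → x ≢ F' → re⊗ x ≡ re x
  re⊗≡re {x} x≢F' with x ≟ F'
  ... | yes x≡F' = ⊥-elim (x≢F' x≡F')
  ... | no _ = refl

  re⊗-F : re⊗ F ≡ tv
  re⊗-F = trans (re⊗≡re F≢F') re-F

  re⊗-old : ∀ {x} → x ≢ F → re⊗ x ≡ old x
  re⊗-old {x} x≢F with x ≟ F | x ≟ F'
  ... | yes x≡F | _ = ⊥-elim (x≢F x≡F)
  ... | no _ | yes refl = refl
  ... | no _ | no _ = refl

  cast-head : ∀ {a b Γ} → a ≡ b → Proof S (a ∷ Γ) → Proof S (b ∷ Γ)
  cast-head {Γ = Γ} e = subst (λ c → Proof S (c ∷ Γ)) e

  cast-tail : ∀ {a Γ Δ} → Γ ≡ Δ → Proof S (a ∷ Γ) → Proof S (a ∷ Δ)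
  cast-tail {a} e = subst (λ Θ → Proof S (a ∷ Θ)) e

  ax-lift : ∀ {v w} → link R v ≡ ax w → Proof S (old v ∷ old w ∷ [])
  ax-lift {v} {w} e = ax-r (trans (link-old v) (cong relink e)) (subst NoJ (sym (lab-ax v w e)) (mll v))

  ⊗-lift : ∀ {v a b Γ Δ} → link R v ≡ tens a b → Proof S (re a ∷ Γ) → Proof S (re b ∷ Δ) → Proof S (old v ∷ Γ ++ Δ)
  ⊗-lift {v} e = ⊗-r (trans (link-old v) (cong relink e))

  ⅋-lift : ∀ {v a b Γ} → link R v ≡ par a b → Proof S (re a ∷ re b ∷ Γ) → Proof S (old v ∷ Γ)
  ⅋-lift {v} e = ⅋-r (trans (link-old v) (cong relink e))

  premise : ∀ {a Γ} → δ F' a ≡ 0 → Proof S (re⊗ a ∷ Γ) → Proof S (re a ∷ Γ)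
  premise a₀ = cast-head (re⊗≡re (δ≡0⇒≢ a₀))

  second-premise : ∀ {b c Γ} → δ F' b ≡ 0 → Proof S (c ∷ re⊗ b ∷ Γ) → Proof S (c ∷ re b ∷ Γ)
  second-premise b₀ = ex-r (↭.swap _ _ ↭.refl) ∘ premise b₀ ∘ ex-r (↭.swap _ _ ↭.refl)

  premises : ∀ {a b Γ} → δ F' a ≡ 0 → δ F' b ≡ 0 → Proof S (re⊗ a ∷ re⊗ b ∷ Γ) → Proof S (re a ∷ re b ∷ Γ)
  premises a₀ b₀ = premise a₀ ∘ second-premise b₀

  conclusion : ∀ {v Γ} → δ F v ≡ 0 → Proof S (old v ∷ Γ) → Proof S (re⊗ v ∷ Γ)
  conclusion v₀ = cast-head (sym (re⊗-old (δ≡0⇒≢ v₀)))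

  tensorJ-here : ∀ {v Γ} → F ≡ v → Proof S (old v ∷ Γ) → Proof S (re⊗ v ∷ Γ ∷ʳ j⊥v)
  tensorJ-here {Γ = Γ} refl π = cast-head (sym re⊗-F) (ex-r (↭.prep tv (∷↭∷ʳ j⊥v Γ)) (⊗J-r link-t link-j lab-j (notJ-old F) π))

  parJ-here : ∀ {a Γ} → F' ≡ a → Proof S (re⊗ a ∷ Γ ∷ʳ j⊥v) → Proof S (re a ∷ Γ)
  parJ-here {Γ = Γ} refl π = cast-head (sym re-F') (⅋J-r link-p lab-j⊥ (notJ-old F') (ex-r (↭-sym (∷↭∷ʳ j⊥v _)) (cast-head re⊗-F' π)))

  liftPlain : ∀ {Γ} (ρ : Proof R Γ) → ᴿ.#created F ρ ≡ 0 → ᴿ.#used F' ρ ≡ 0 → Proof S (map re⊗ Γ)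
  liftPlain (ax-r {v} {w} e _) c₀ _ with +≡0 (δ F v) c₀
  ... | v₀ , w₀ = conclusion v₀ (ex-r (↭.swap _ _ ↭.refl) (conclusion w₀ (ex-r (↭.swap _ _ ↭.refl) (ax-lift e))))
  liftPlain (⊗-r {v} {a} {b} {Γ} {Δ} e π₁ π₂) c₀ u₀
    with +≡0 (δ F v) c₀ | +≡0₄ (δ F' a) (δ F' b) (ᴿ.#used F' π₁) u₀
  ... | v₀ , c₁₂ | a₀ , b₀ , u₁ , u₂ = let (c₁ , c₂) = +≡0 (ᴿ.#created F π₁) c₁₂ in
    conclusion v₀ (cast-tail (sym (map-++ re⊗ Γ Δ)) (⊗-lift e (premise a₀ (liftPlain π₁ c₁ u₁)) (premise b₀ (liftPlain π₂ c₂ u₂))))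
  liftPlain (⅋-r {v} {a} {b} e π) c₀ u₀ with +≡0 (δ F v) c₀ | +≡0₃ (δ F' a) (δ F' b) u₀
  ... | v₀ , c | a₀ , b₀ , u = conclusion v₀ (⅋-lift e (premises a₀ b₀ (liftPlain π c u)))
  liftPlain (⊗J-r _ _ isJ _ _) _ _ = ⊥-elim (lab≢J isJ)
  liftPlain (⅋J-r _ isJ⊥ _ _) _ _ = ⊥-elim (lab≢J⊥ isJ⊥)
  liftPlain (ex-r p π) c₀ u₀ = ex-r (map⁺ re⊗ p) (liftPlain π c₀ u₀)

  liftTensorJ : ∀ {Γ} (ρ : Proof R Γ) → ᴿ.#created F ρ ≡ 1 → ᴿ.#used F' ρ ≡ 0 → Proof S (map re⊗ Γ ∷ʳ j⊥v)
  liftTensorJ (ax-r {v} {w} e _) c₁ _ with +≡1 (δ F v) c₁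
  ... | inj₁ (v₁ , w₀) = tensorJ-here (δ≡1⇒≡ v₁) (ex-r (↭.swap _ _ ↭.refl) (conclusion w₀ (ex-r (↭.swap _ _ ↭.refl) (ax-lift e))))
  ... | inj₂ (v₀ , w₁) = conclusion v₀ (ex-r (↭.swap _ _ ↭.refl) (tensorJ-here (δ≡1⇒≡ w₁) (ex-r (↭.swap _ _ ↭.refl) (ax-lift e))))
  liftTensorJ (⊗-r {v} {a} {b} {Γ} {Δ} e π₁ π₂) c₁ u₀
    with +≡0₄ (δ F' a) (δ F' b) (ᴿ.#used F' π₁) u₀ | +≡1 (δ F v) c₁
  ... | a₀ , b₀ , u₁ , u₂ | inj₁ (v₁ , c₁₂) =
    let (c₁ , c₂) = +≡0 (ᴿ.#created F π₁) c₁₂ in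
    cast-tail (cong (_∷ʳ j⊥v) (sym (map-++ re⊗ Γ Δ)))
      (tensorJ-here (δ≡1⇒≡ v₁) (⊗-lift e (premise a₀ (liftPlain π₁ c₁ u₁)) (premise b₀ (liftPlain π₂ c₂ u₂))))
  ... | a₀ , b₀ , u₁ , u₂ | inj₂ (v₀ , c₁₂) with +≡1 (ᴿ.#created F π₁) c₁₂
  ...   | inj₁ (c₁ , c₂) =
    conclusion v₀ (cast-tail (cong (_∷ʳ j⊥v) (sym (map-++ re⊗ Γ Δ))) (ex-r (↭.prep (old v) (∷ʳ-++-↭ (map re⊗ Γ) j⊥v (map re⊗ Δ)))
      (⊗-lift e (premise a₀ (liftTensorJ π₁ c₁ u₁)) (premise b₀ (liftPlain π₂ c₂ u₂)))))
  ...   | inj₂ (c₁ , c₂) =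
    conclusion v₀ (cast-tail (trans (sym (++-assoc (map re⊗ Γ) (map re⊗ Δ) _)) (cong (_∷ʳ j⊥v) (sym (map-++ re⊗ Γ Δ))))
      (⊗-lift e (premise a₀ (liftPlain π₁ c₁ u₁)) (premise b₀ (liftTensorJ π₂ c₂ u₂))))
  liftTensorJ (⅋-r {v} {a} {b} e π) c₁ u₀ with +≡0₃ (δ F' a) (δ F' b) u₀ | +≡1 (δ F v) c₁
  ... | a₀ , b₀ , u | inj₁ (v₁ , c) = tensorJ-here (δ≡1⇒≡ v₁) (⅋-lift e (premises a₀ b₀ (liftPlain π c u)))
  ... | a₀ , b₀ , u | inj₂ (v₀ , c) = conclusion v₀ (⅋-lift e (premises a₀ b₀ (liftTensorJ π c u)))
  liftTensorJ (⊗J-r _ _ isJ _ _) _ _ = ⊥-elim (lab≢J isJ)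
  liftTensorJ (⅋J-r _ isJ⊥ _ _) _ _ = ⊥-elim (lab≢J⊥ isJ⊥)
  liftTensorJ (ex-r p π) c₁ u₀ = ex-r (++⁺ʳ (j⊥v ∷ []) (map⁺ re⊗ p)) (liftTensorJ π c₁ u₀)

  liftParJ : ∀ {Γ} (ρ : Proof R Γ) → ᴿ.#created F ρ ≡ 1 → ᴿ.#used F' ρ ≡ 1 → ᴿ.#created F' ρ ≤ 1 →
             ᴿ.AboveUse F F' ρ → Proof S (map re⊗ Γ)

  liftParJ-⊗ : ∀ {v a b Γ Δ} (e : link R v ≡ tens a b) (π₁ : Proof R (a ∷ Γ)) (π₂ : Proof R (b ∷ Δ)) →
               ᴿ.#created F (⊗-r e π₁ π₂) ≡ 1 → ᴿ.#used F' (⊗-r e π₁ π₂) ≡ 1 → ᴿ.#created F' (⊗-r e π₁ π₂) ≤ 1 →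
               ᴿ.AboveUse F F' (⊗-r e π₁ π₂) → Proof S (re⊗ v ∷ map re⊗ Γ ++ map re⊗ Δ)

  liftParJ (ax-r _ _) _ () _ _
  liftParJ (⊗-r {Γ = Γ} {Δ} e π₁ π₂) c₁ u₁ c'₁ above = cast-tail (sym (map-++ re⊗ Γ Δ)) (liftParJ-⊗ e π₁ π₂ c₁ u₁ c'₁ above)
  liftParJ (⅋-r {v} {a} {b} e π) c₁ u₁ _ (_ , _ , here , inj₁ F'≡a , _ , _ , ⅋◃ , _ , F∈π)
    with +≡1ʳ (δ F v) c₁ (ᴿ.createdIn⇒#created>0 π F∈π) | +≡1-first₃ (δ F' a) (δ F' b) u₁ (≡⇒δ>0 F'≡a)
  ... | v₀ , c | b₀ , uπ = conclusion v₀ (⅋-lift e (second-premise b₀ (parJ-here F'≡a (liftTensorJ π c uπ))))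
  liftParJ (⅋-r {v} {a} {b} e π) c₁ u₁ _ (_ , _ , here , inj₂ F'≡b , _ , _ , ⅋◃ , _ , F∈π)
    with +≡1ʳ (δ F v) c₁ (ᴿ.createdIn⇒#created>0 π F∈π) | +≡1-second₃ (δ F' a) (δ F' b) u₁ (≡⇒δ>0 F'≡b)
  ... | v₀ , c | a₀ , uπ = conclusion v₀ (⅋-lift e (premise a₀
    (ex-r (↭.swap _ _ ↭.refl) (parJ-here F'≡b (ex-r (↭.swap _ _ ↭.refl) (liftTensorJ π c uπ))))))
  liftParJ (⅋-r {v} {a} {b} e π) c₁ u₁ c'₁ (_ , σ , there σ≼π ⅋◃ , u , rest@(_ , _ , σ'◃σ , _ , F∈σ'))
    with +≡1ʳ (δ F v) c₁ (ᴿ.createdIn⇒#created>0 π (ᴿ.createdIn-≼ F∈σ' (ᴿ.≼-trans (ᴿ.◃⇒≼ σ'◃σ) σ≼π)))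
       | +≡1-last₃ (δ F' a) (δ F' b) u₁ (ᴿ.usedIn⇒#used>0 π (_ , σ , σ≼π , u))
  ... | v₀ , c | a₀ , b₀ , uπ =
    conclusion v₀ (⅋-lift e (premises a₀ b₀ (liftParJ π c uπ (≤-trans (m≤n+m _ (δ F' v)) c'₁) (_ , σ , σ≼π , u , rest))))
  liftParJ (⊗J-r _ _ isJ _ _) _ _ _ _ = ⊥-elim (lab≢J isJ)
  liftParJ (⅋J-r _ isJ⊥ _ _) _ _ _ _ = ⊥-elim (lab≢J⊥ isJ⊥)
  liftParJ (ex-r p π) c₁ u₁ c'₁ (_ , σ , there σ≼π ex◃ , u , rest) =
    ex-r (map⁺ re⊗ p) (liftParJ π c₁ u₁ c'₁ (_ , σ , σ≼π , u , rest))

  liftParJ-⊗ {v} {a} {b} e π₁ π₂ c₁ u₁ _ (_ , _ , here , inj₁ F'≡a , _ , _ , ⊗-l◃ , _ , F∈π₁)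
    with +≡1-middle (δ F v) (ᴿ.#created F π₁) c₁ (ᴿ.createdIn⇒#created>0 π₁ F∈π₁) | +≡1-first₃ (δ F' a) (δ F' b) u₁ (≡⇒δ>0 F'≡a)
  ... | v₀ , cπ₁ , cπ₂ | b₀ , u₁₂ = let (uπ₁ , uπ₂) = +≡0 (ᴿ.#used F' π₁) u₁₂ in
    conclusion v₀ (⊗-lift e (parJ-here F'≡a (liftTensorJ π₁ cπ₁ uπ₁)) (premise b₀ (liftPlain π₂ cπ₂ uπ₂)))
  liftParJ-⊗ {v} {a} {b} e π₁ π₂ c₁ u₁ _ (_ , _ , here , inj₂ F'≡b , _ , _ , ⊗-r◃ , _ , F∈π₂)
    with +≡1-last (δ F v) (ᴿ.#created F π₁) c₁ (ᴿ.createdIn⇒#created>0 π₂ F∈π₂) | +≡1-second₃ (δ F' a) (δ F' b) u₁ (≡⇒δ>0 F'≡b)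
  ... | v₀ , cπ₁ , cπ₂ | a₀ , u₁₂ = let (uπ₁ , uπ₂) = +≡0 (ᴿ.#used F' π₁) u₁₂ in
    conclusion v₀ (⊗-lift e (premise a₀ (liftPlain π₁ cπ₁ uπ₁)) (parJ-here F'≡b (liftTensorJ π₂ cπ₂ uπ₂)))
  liftParJ-⊗ {v} e π₁ π₂ _ _ c'₁ (_ , _ , here , inj₁ F'≡a , _ , _ , ⊗-r◃ , F'∈Δ , _) =
    ⊥-elim (positive-summands≰1 (δ F' v) (ᴿ.createdIn⇒#created>0 π₁ (ᴿ.∈⇒createdIn π₁ (here F'≡a)))
                                          (ᴿ.createdIn⇒#created>0 π₂ (ᴿ.∈⇒createdIn π₂ F'∈Δ)) c'₁)
  liftParJ-⊗ {v} e π₁ π₂ _ _ c'₁ (_ , _ , here , inj₂ F'≡b , _ , _ , ⊗-l◃ , F'∈Γ , _) =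
    ⊥-elim (positive-summands≰1 (δ F' v) (ᴿ.createdIn⇒#created>0 π₁ (ᴿ.∈⇒createdIn π₁ F'∈Γ))
                                          (ᴿ.createdIn⇒#created>0 π₂ (ᴿ.∈⇒createdIn π₂ (here F'≡b))) c'₁)
  liftParJ-⊗ {v} {a} {b} e π₁ π₂ c₁ u₁ c'₁ (_ , σ , there σ≼π₁ ⊗-l◃ , u , rest@(_ , _ , σ'◃σ , _ , F∈σ'))
    with +≡1-middle (δ F v) (ᴿ.#created F π₁) c₁ (ᴿ.createdIn⇒#created>0 π₁ (ᴿ.createdIn-≼ F∈σ' (ᴿ.≼-trans (ᴿ.◃⇒≼ σ'◃σ) σ≼π₁)))
       | +≡1-third₄ (δ F' a) (δ F' b) (ᴿ.#used F' π₁) u₁ (ᴿ.usedIn⇒#used>0 π₁ (_ , σ , σ≼π₁ , u))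
  ... | v₀ , cπ₁ , cπ₂ | a₀ , b₀ , uπ₁ , uπ₂ =
    conclusion v₀ (⊗-lift e (premise a₀ (liftParJ π₁ cπ₁ uπ₁ (≤-trans (≤-middle (δ F' v) _ _) c'₁) (_ , σ , σ≼π₁ , u , rest)))
                            (premise b₀ (liftPlain π₂ cπ₂ uπ₂)))
  liftParJ-⊗ {v} {a} {b} e π₁ π₂ c₁ u₁ c'₁ (_ , σ , there σ≼π₂ ⊗-r◃ , u , rest@(_ , _ , σ'◃σ , _ , F∈σ'))
    with +≡1-last (δ F v) (ᴿ.#created F π₁) c₁ (ᴿ.createdIn⇒#created>0 π₂ (ᴿ.createdIn-≼ F∈σ' (ᴿ.≼-trans (ᴿ.◃⇒≼ σ'◃σ) σ≼π₂)))
       | +≡1-fourth₄ (δ F' a) (δ F' b) (ᴿ.#used F' π₁) u₁ (ᴿ.usedIn⇒#used>0 π₂ (_ , σ , σ≼π₂ , u))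
  ... | v₀ , cπ₁ , cπ₂ | a₀ , b₀ , uπ₁ , uπ₂ =
    conclusion v₀ (⊗-lift e (premise a₀ (liftPlain π₁ cπ₁ uπ₁))
                            (premise b₀ (liftParJ π₂ cπ₂ uπ₂ (≤-trans (≤-last (δ F' v) _ _) c'₁) (_ , σ , σ≼π₂ , u , rest))))

  lift-conclusions : ∀ {Γ} → ConclusionList R Γ → ConclusionList S (map re Γ)
  lift-conclusions {Γ} (unique , ∈⇔conclusion) = Unique.map⁺ re-injective unique , λ v → mk⇔ (to v) from
    where
      to : ∀ v → v ∈ map re Γ → IsConclusion S v
      to v v∈ with ∈-map⁻ re v∈
      ... | x , x∈Γ , refl = conclusion-re (Equivalence.to (∈⇔conclusion x) x∈Γ)
      from : ∀ {v} → IsConclusion S v → v ∈ map re Γ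
      from c with conclusion-renamed c
      ... | x , refl = ∈-map⁺ re (Equivalence.from (∈⇔conclusion x) (conclusion-re⁻ c))

  map-re⊗≡map-re : ∀ {Γ} → F' ∉ Γ → map re⊗ Γ ≡ map re Γ
  map-re⊗≡map-re F'∉Γ = map-cong-local (All.tabulate λ {x} x∈Γ → re⊗≡re {x} λ { refl → F'∉Γ x∈Γ })

  parJ-at-conclusion : ∀ {Γ} → Unique Γ → F' ∈ Γ → Proof S (map re⊗ Γ ∷ʳ j⊥v) → Proof S (map re Γ)
  parJ-at-conclusion unique F'∈Γ π with ∈-∃++ F'∈Γ
  ... | A , B , refl = ex-r (map⁺ re (↭-sym (shift F' A B)))
    (parJ-here refl (cast-tail (cong (_∷ʳ j⊥v) (map-re⊗≡map-re (unique-∉-rest A B unique)))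
      (ex-r (++⁺ʳ (j⊥v ∷ []) (map⁺ re⊗ (shift F' A B))) π)))

  backward : SeqWithAbove R F F' → Correct S
  backward (σR , above) = record { concl = map re Γ ; isConcl = lift-conclusions cl ; proof = lift above }
    where
      Γ : List (Fin n)
      Γ = concl σR
      cl : ConclusionList R Γ
      cl = isConcl σR
      π : Proof R Γ
      π = proof σR
      lift : Above R F F' π → Proof S (map re Γ)
      lift (inj₁ (F'∈Γ , _)) = parJ-at-conclusion (proj₁ cl) F'∈Γ
        (liftTensorJ π (created-once cl π F) (#used-conclusion (Equivalence.to (proj₂ cl F') F'∈Γ) π))
      lift (inj₂ aboveUse@(_ , σ , σ≼π , u , _)) =
        subst (Proof S) (map-re⊗≡map-re F'∉Γ) (liftParJ π (created-once cl π F) used≡1 (≤-reflexive (created-once cl π F')) aboveUse)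
        where
          occ≡0×used≡1 : #occ F' Γ ≡ 0 × ᴿ.#used F' π ≡ 1
          occ≡0×used≡1 = +≡1ʳ (#occ F' Γ) (trans (sym (ᴿ.#created≡#occ+#used F' π)) (created-once cl π F'))
                                (ᴿ.usedIn⇒#used>0 π (_ , σ , σ≼π , u))
          used≡1 : ᴿ.#used F' π ≡ 1
          used≡1 = proj₂ occ≡0×used≡1
          F'∉Γ : F' ∉ Γ
          F'∉Γ F'∈Γ with #occ-∈ F'∈Γ
          ... | occ>0 rewrite proj₁ occ≡0×used≡1 with occ>0
          ...   | ()

  -- Sequentializations of J_{F→F'}(R) erase to sequentializations of R

  eraseNew : Fin 4 → Maybe (Fin n)
  eraseNew zero = nothing
  eraseNew (suc zero) = nothing
  eraseNew (suc (suc zero)) = just F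
  eraseNew (suc (suc (suc zero))) = just F'

  erase : Fin (n + 4) → Maybe (Fin n)
  erase = caseVertex just eraseNew

  erase-re : ∀ x → erase (re x) ≡ just x
  erase-re x with renamed x
  ... | F↦tv refl e = trans (cong erase e) (caseVertex-new just eraseNew _)
  ... | F'↦pv refl e = trans (cong erase e) (caseVertex-new just eraseNew _)
  ... | old↦old _ _ e = trans (cong erase e) (caseVertex-old just eraseNew x)

  erased : List (Fin (n + 4)) → List (Fin n)
  erased = mapMaybe erase

  erased-∷ : ∀ {y m} L → erase y ≡ m → erased (y ∷ L) ≡ maybe′ _∷_ id m (erased L)
  erased-∷ L e = cong (λ m → maybe′ _∷_ id m (erased L)) e

  erased-old : ∀ x L → erased (old x ∷ L) ≡ x ∷ erased L
  erased-old x L = erased-∷ L (caseVertex-old just eraseNew x)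

  erased-re : ∀ x L → erased (re x ∷ L) ≡ x ∷ erased L
  erased-re x L = erased-∷ L (erase-re x)

  erased-j⊥ : ∀ L → erased (j⊥v ∷ L) ≡ erased L
  erased-j⊥ L = erased-∷ L (caseVertex-new just eraseNew _)

  erased-t : ∀ L → erased (tv ∷ L) ≡ F ∷ erased L
  erased-t L = erased-∷ L (caseVertex-new just eraseNew _)

  erased-p : ∀ L → erased (pv ∷ L) ≡ F' ∷ erased L
  erased-p L = erased-∷ L (caseVertex-new just eraseNew _)

  notJ-re : ∀ x → NotJAtom (lab S (re x))
  notJ-re x with renamed x
  ... | F↦tv _ e = subst (NotJAtom ∘ lab S) (sym e) (⊗⇒NotJAtom (tens-lab S tv _ _ link-t))
  ... | F'↦pv _ e = subst (NotJAtom ∘ lab S) (sym e) (⅋⇒NotJAtom (par-lab S pv _ _ link-p))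
  ... | old↦old _ _ e = subst (NotJAtom ∘ lab S) (sym e) (notJ-old x)

  ¬NoJ-jv : ¬ NoJ (lab S jv)
  ¬NoJ-jv noJ with subst NoJ lab-j noJ
  ... | ()

  ¬NoJ-j⊥v : ¬ NoJ (lab S j⊥v)
  ¬NoJ-j⊥v noJ with subst NoJ lab-j⊥ noJ
  ... | ()

  jv∉context : ∀ {Γ} → Proof S Γ → jv ∉ Γ
  jv∉context (ax-r _ noJ) (here refl) = ¬NoJ-jv noJ
  jv∉context (ax-r e noJ) (there (here jv≡w)) with axiom-link e
  ... | old-axiom {y = y} _ = old≢new y _ (sym jv≡w)
  ... | j-axiom = jv≢j⊥v jv≡w
  ... | j⊥-axiom = ¬NoJ-j⊥v noJ
  jv∉context (⊗-r e _ _) (here refl) with trans (sym link-j) e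
  ... | ()
  jv∉context (⊗-r {Γ = Γ} _ π₁ π₂) (there jv∈) with ∈-++⁻ Γ jv∈
  ... | inj₁ jv∈Γ = jv∉context π₁ (there jv∈Γ)
  ... | inj₂ jv∈Δ = jv∉context π₂ (there jv∈Δ)
  jv∉context (⅋-r e _) (here refl) with trans (sym link-j) e
  ... | ()
  jv∉context (⅋-r _ π) (there jv∈) = jv∉context π (there (there jv∈))
  jv∉context (⊗J-r e _ _ _ _) (here refl) with trans (sym link-j) e
  ... | ()
  jv∉context (⊗J-r _ e' isJ _ _) (there (here jv≡k)) with trans (sym link-j) (ax-sym S _ _ (subst (λ k → link S _ ≡ ax k) (sym jv≡k) e'))
  ... | refl with trans (sym lab-j⊥) isJ
  ...   | ()
  jv∉context (⊗J-r _ _ _ _ π) (there (there jv∈)) = jv∉context π (there jv∈)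
  jv∉context (⅋J-r e _ _ _) (here refl) with trans (sym link-j) e
  ... | ()
  jv∉context (⅋J-r _ _ _ π) (there jv∈) = jv∉context π (there (there jv∈))
  jv∉context (ex-r p π) jv∈ = jv∉context π (∈-resp-↭ (↭-sym p) jv∈)

  erased-axiom : ∀ x y → erased (old x ∷ old y ∷ []) ≡ x ∷ y ∷ []
  erased-axiom x y = trans (erased-old x (old y ∷ [])) (cong (x ∷_) (erased-old y []))

  erased-binary : ∀ x Γ Δ → erased (old x ∷ Γ ++ Δ) ≡ x ∷ erased Γ ++ erased Δ
  erased-binary x Γ Δ = trans (erased-old x (Γ ++ Δ)) (cong (x ∷_) (mapMaybe-++ erase Γ Δ))

  erased-premises : ∀ a b Γ → erased (re a ∷ re b ∷ Γ) ≡ a ∷ b ∷ erased Γ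
  erased-premises a b Γ = trans (erased-re a (re b ∷ Γ)) (cong (a ∷_) (erased-re b Γ))

  erased-tensor-gadget : ∀ Γ → erased (old F ∷ Γ) ≡ erased (tv ∷ j⊥v ∷ Γ)
  erased-tensor-gadget Γ = trans (erased-old F Γ) (sym (trans (erased-t (j⊥v ∷ Γ)) (cong (F ∷_) (erased-j⊥ Γ))))

  erased-par-gadget : ∀ Γ → erased (j⊥v ∷ old F' ∷ Γ) ≡ erased (pv ∷ Γ)
  erased-par-gadget Γ = trans (erased-j⊥ (old F' ∷ Γ)) (trans (erased-old F' Γ) (sym (erased-p Γ)))

  ax-inj : ∀ {m} {a b : Fin m} → Link.ax a ≡ ax b → a ≡ b
  ax-inj refl = refl

  erase-proof : ∀ {Γ} → Proof S Γ → Proof R (erased Γ)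
  erase-proof (ax-r e noJ) with axiom-link e
  ... | old-axiom {x} {y} eq = subst (Proof R) (sym (erased-axiom x y)) (ax-r eq (mll x))
  ... | j-axiom = ⊥-elim (¬NoJ-jv noJ)
  ... | j⊥-axiom = ⊥-elim (¬NoJ-j⊥v noJ)
  erase-proof (⊗-r {Γ = Γ} {Δ} e π₁ π₂) with tensor-link e
  ... | old-tensor {x} {a} {b} eq =
    subst (Proof R) (sym (erased-binary x Γ Δ)) (⊗-r eq (subst (Proof R) (erased-re a Γ) (erase-proof π₁)) (subst (Proof R) (erased-re b Δ) (erase-proof π₂)))
  ... | gadget-tensor = ⊥-elim (jv∉context π₂ (here refl))
  erase-proof (⅋-r {Γ = Γ} e π) with par-link e
  ... | old-par {x} {a} {b} eq = subst (Proof R) (sym (erased-old x Γ)) (⅋-r eq (subst (Proof R) (erased-premises a b Γ) (erase-proof π)))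
  ... | gadget-par = subst (Proof R) (erased-par-gadget Γ) (erase-proof π)
  erase-proof (⊗J-r {Γ = Γ} e e' isJ _ π) with tensor-link e
  ... | old-tensor {b = b} _ = ⊥-elim (proj₁ (notJ-re b) isJ)
  ... | gadget-tensor with ax-inj (trans (sym link-j) e')
  ...   | refl = subst (Proof R) (erased-tensor-gadget Γ) (erase-proof π)
  erase-proof (⅋J-r {Γ = Γ} e isJ⊥ _ π) with par-link e
  ... | old-par {a = a} _ = ⊥-elim (proj₂ (notJ-re a) isJ⊥)
  ... | gadget-par = subst (Proof R) (erased-par-gadget Γ) (erase-proof π)
  erase-proof (ex-r p π) = ex-r (mapMaybe-↭ erase p) (erase-proof π)

  erase-◃ : ∀ {Δ Γ} {ρ : Proof S Δ} {π : Proof S Γ} → _◃_ S ρ π → _≼_ R (erase-proof ρ) (erase-proof π)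
  erase-◃ (⊗-l◃ {Γ = Γ} {Δ} {e} {π₂ = π₂}) with tensor-link e
  ... | old-tensor {x} {a} eq = ᴿ.≼-subst (sym (erased-binary x Γ Δ)) (there (ᴿ.≼-subst (erased-re a Γ) here) ⊗-l◃)
  ... | gadget-tensor = ⊥-elim (jv∉context π₂ (here refl))
  erase-◃ (⊗-r◃ {Γ = Γ} {Δ} {e} {π₂ = π₂}) with tensor-link e
  ... | old-tensor {x} {b = b} eq = ᴿ.≼-subst (sym (erased-binary x Γ Δ)) (there (ᴿ.≼-subst (erased-re b Δ) here) ⊗-r◃)
  ... | gadget-tensor = ⊥-elim (jv∉context π₂ (here refl))
  erase-◃ (⅋◃ {Γ = Γ} {e}) with par-link e
  ... | old-par {x} {a} {b} eq = ᴿ.≼-subst (sym (erased-old x Γ)) (there (ᴿ.≼-subst (erased-premises a b Γ) here) ⅋◃)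
  ... | gadget-par = ᴿ.≼-subst (erased-par-gadget Γ) here
  erase-◃ (⊗J◃ {Γ = Γ} {e} {e'} {isJ}) with tensor-link e
  ... | old-tensor {b = b} _ = ⊥-elim (proj₁ (notJ-re b) isJ)
  ... | gadget-tensor with ax-inj (trans (sym link-j) e')
  ...   | refl = ᴿ.≼-subst (erased-tensor-gadget Γ) here
  erase-◃ (⅋J◃ {Γ = Γ} {e} {isJ⊥}) with par-link e
  ... | old-par {a = a} _ = ⊥-elim (proj₂ (notJ-re a) isJ⊥)
  ... | gadget-par = ᴿ.≼-subst (erased-par-gadget Γ) here
  erase-◃ ex◃ = ᴿ.◃⇒≼ ex◃

  erase-≼ : ∀ {Δ Γ} {ρ : Proof S Δ} {π : Proof S Γ} → _≼_ S ρ π → _≼_ R (erase-proof ρ) (erase-proof π)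
  erase-≼ here = here
  erase-≼ (there ρ≼σ σ◃π) = ᴿ.≼-trans (erase-≼ ρ≼σ) (erase-◃ σ◃π)

  δ-old : ∀ x y → δ (old x) (old y) ≡ δ x y
  δ-old x y with x ≟ y
  ... | yes refl = δ-refl (old x)
  ... | no x≢y = δ-≢ {x = old x} {old y} (x≢y ∘ old-injective)

  δ-old-new : ∀ x j → δ (old x) (n ↑ʳ j) ≡ 0
  δ-old-new x j = δ-≢ (old≢new x j)

  #created-erase : ∀ x {Γ} (π : Proof S Γ) → ᴿ.#created x (erase-proof π) ≡ ˢ.#created (old x) π
  #created-erase x (ax-r e noJ) with axiom-link e
  ... | old-axiom {x'} {y} eq = trans (ᴿ.#created-subst x (sym (erased-axiom x' y)) _) (sym (cong₂ _+_ (δ-old x x') (δ-old x y)))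
  ... | j-axiom = ⊥-elim (¬NoJ-jv noJ)
  ... | j⊥-axiom = ⊥-elim (¬NoJ-j⊥v noJ)
  #created-erase x (⊗-r {Γ = Γ} {Δ} e π₁ π₂) with tensor-link e
  ... | old-tensor {x'} {a} {b} eq = trans (ᴿ.#created-subst x (sym (erased-binary x' Γ Δ)) _)
          (cong₂ _+_ (sym (δ-old x x')) (cong₂ _+_ (trans (ᴿ.#created-subst x (erased-re a Γ) (erase-proof π₁)) (#created-erase x π₁))
                                                    (trans (ᴿ.#created-subst x (erased-re b Δ) (erase-proof π₂)) (#created-erase x π₂))))
  ... | gadget-tensor = ⊥-elim (jv∉context π₂ (here refl))
  #created-erase x (⅋-r {Γ = Γ} e π) with par-link e
  ... | old-par {x'} {a} {b} eq = trans (ᴿ.#created-subst x (sym (erased-old x' Γ)) _)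
          (cong₂ _+_ (sym (δ-old x x')) (trans (ᴿ.#created-subst x (erased-premises a b Γ) (erase-proof π)) (#created-erase x π)))
  ... | gadget-par = trans (ᴿ.#created-subst x (erased-par-gadget Γ) (erase-proof π))
          (trans (#created-erase x π) (cong (_+ ˢ.#created (old x) π) (sym (δ-old-new x _))))
  #created-erase x (⊗J-r {Γ = Γ} e e' isJ _ π) with tensor-link e
  ... | old-tensor {b = b} _ = ⊥-elim (proj₁ (notJ-re b) isJ)
  ... | gadget-tensor with ax-inj (trans (sym link-j) e')
  ...   | refl = trans (ᴿ.#created-subst x (erased-tensor-gadget Γ) (erase-proof π)) (trans (#created-erase x π)
                   (sym (cong₂ _+_ (δ-old-new x _) (cong₂ _+_ (δ-old-new x _) (cong₂ _+_ (δ-old-new x _) refl)))))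
  #created-erase x (⅋J-r {Γ = Γ} e isJ⊥ _ π) with par-link e
  ... | old-par {a = a} _ = ⊥-elim (proj₂ (notJ-re a) isJ⊥)
  ... | gadget-par = trans (ᴿ.#created-subst x (erased-par-gadget Γ) (erase-proof π))
          (trans (#created-erase x π) (cong (_+ ˢ.#created (old x) π) (sym (δ-old-new x _))))
  #created-erase x (ex-r _ π) = #created-erase x π

  creates-j⊥v⇒createdIn-F : ∀ {Γ} (ρ : Proof S Γ) → Creates S j⊥v ρ → CreatedIn R F (erase-proof ρ)
  creates-j⊥v⇒createdIn-F (ax-r e noJ) c with axiom-link e | c
  ... | old-axiom {x} _ | inj₁ j⊥v≡old = ⊥-elim (old≢new x _ (sym j⊥v≡old))
  ... | old-axiom {y = y} _ | inj₂ j⊥v≡old = ⊥-elim (old≢new y _ (sym j⊥v≡old))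
  ... | j-axiom | _ = ⊥-elim (¬NoJ-jv noJ)
  ... | j⊥-axiom | _ = ⊥-elim (¬NoJ-j⊥v noJ)
  creates-j⊥v⇒createdIn-F (⊗-r e _ _) refl with trans (sym link-j⊥) e
  ... | ()
  creates-j⊥v⇒createdIn-F (⅋-r e _) refl with trans (sym link-j⊥) e
  ... | ()
  creates-j⊥v⇒createdIn-F (⊗J-r {Γ = Γ} e e' isJ _ π) c with tensor-link e
  ... | old-tensor {b = b} _ = ⊥-elim (proj₁ (notJ-re b) isJ)
  ... | gadget-tensor with ax-inj (trans (sym link-j) e')
  ...   | refl = ᴿ.createdIn-subst (erased-tensor-gadget Γ) (ᴿ.∈⇒createdIn (erase-proof π) (subst (F ∈_) (sym (erased-old F Γ)) (here refl)))
  creates-j⊥v⇒createdIn-F (⅋J-r e _ _ _) refl with trans (sym link-j⊥) e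
  ... | ()

  createdIn-j⊥v⇒createdIn-F : ∀ {Γ} (π : Proof S Γ) → CreatedIn S j⊥v π → CreatedIn R F (erase-proof π)
  createdIn-j⊥v⇒createdIn-F π (_ , ρ , ρ≼π , c) = ᴿ.createdIn-≼ (creates-j⊥v⇒createdIn-F ρ c) (erase-≼ ρ≼π)

  creates-pv⇒createdIn-F : ∀ {Γ} (ρ : Proof S Γ) → Creates S pv ρ → CreatedIn R F (erase-proof ρ)
  creates-pv⇒createdIn-F (ax-r e noJ) c with axiom-link e | c
  ... | old-axiom {x} _ | inj₁ pv≡old = ⊥-elim (old≢new x _ (sym pv≡old))
  ... | old-axiom {y = y} _ | inj₂ pv≡old = ⊥-elim (old≢new y _ (sym pv≡old))
  ... | j-axiom | _ = ⊥-elim (¬NoJ-jv noJ)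
  ... | j⊥-axiom | _ = ⊥-elim (¬NoJ-j⊥v noJ)
  creates-pv⇒createdIn-F (⊗-r e _ _) refl with trans (sym link-p) e
  ... | ()
  creates-pv⇒createdIn-F (⅋-r {Γ = Γ} e π) c with par-link e
  ... | old-par {x} _ = ⊥-elim (old≢new x _ (sym c))
  ... | gadget-par = ᴿ.createdIn-subst (erased-par-gadget Γ) (createdIn-j⊥v⇒createdIn-F π (ˢ.∈⇒createdIn π (here refl)))
  creates-pv⇒createdIn-F (⊗J-r e e' isJ _ _) c with tensor-link e
  ... | old-tensor {b = b} _ = ⊥-elim (proj₁ (notJ-re b) isJ)
  ... | gadget-tensor with ax-inj (trans (sym link-j) e') | c
  ...   | refl | inj₁ pv≡tv = ⊥-elim (tv≢pv (sym pv≡tv))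
  ...   | refl | inj₂ (inj₁ pv≡jv) = ⊥-elim (jv≢pv (sym pv≡jv))
  ...   | refl | inj₂ (inj₂ pv≡j⊥v) = ⊥-elim (j⊥v≢pv (sym pv≡j⊥v))
  creates-pv⇒createdIn-F (⅋J-r {Γ = Γ} e _ _ π) c with par-link e
  ... | old-par {x} _ = ⊥-elim (old≢new x _ (sym c))
  ... | gadget-par = ᴿ.createdIn-subst (erased-par-gadget Γ) (createdIn-j⊥v⇒createdIn-F π (ˢ.∈⇒createdIn π (here refl)))

  createdIn-pv⇒createdIn-F : ∀ {Γ} (π : Proof S Γ) → CreatedIn S pv π → CreatedIn R F (erase-proof π)
  createdIn-pv⇒createdIn-F π (_ , ρ , ρ≼π , c) = ᴿ.createdIn-≼ (creates-pv⇒createdIn-F ρ c) (erase-≼ ρ≼π)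

  pv≢old : ∀ x → pv ≢ old x
  pv≢old x = old≢new x _ ∘ sym

  uses-pv⇒aboveUse : ∀ {Δ Γ} (σ : Proof S Δ) {π : Proof S Γ} → _≼_ S σ π → Uses S pv σ → ᴿ.AboveUse F F' (erase-proof π)
  uses-pv⇒aboveUse (⊗-r {Γ = Γ} {Δ} e π₁ π₂) {π} σ≼π u with tensor-link e | erase-≼ σ≼π
  ... | old-tensor {x} {a} {b} eq | σ≼π = _ , _ , ᴿ.≼-trans (ᴿ.≼-subst (sym (erased-binary x Γ Δ)) here) σ≼π , by-side u
    where
      by-side : pv ≡ re a ⊎ pv ≡ re b →
                ᴿ.CreatedAboveUse F F' (⊗-r eq (subst (Proof R) (erased-re a Γ) (erase-proof π₁)) (subst (Proof R) (erased-re b Δ) (erase-proof π₂)))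
      by-side (inj₁ pv≡a) = inj₁ F'≡a , _ , _ , ⊗-l◃ , here F'≡a , ᴿ.createdIn-subst (erased-re a Γ) (createdIn-pv⇒createdIn-F π₁ (ˢ.∈⇒createdIn π₁ (here pv≡a)))
        where F'≡a : F' ≡ a
              F'≡a = re-injective (trans re-F' pv≡a)
      by-side (inj₂ pv≡b) = inj₂ F'≡b , _ , _ , ⊗-r◃ , here F'≡b , ᴿ.createdIn-subst (erased-re b Δ) (createdIn-pv⇒createdIn-F π₂ (ˢ.∈⇒createdIn π₂ (here pv≡b)))
        where F'≡b : F' ≡ b
              F'≡b = re-injective (trans re-F' pv≡b)
  ... | gadget-tensor | _ = ⊥-elim ([ pv≢old F , jv≢pv ∘ sym ]′ u)
  uses-pv⇒aboveUse (⅋-r {Γ = Γ} e π₀) σ≼π u with par-link e | erase-≼ σ≼π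
  ... | old-par {x} {a} {b} eq | σ≼π = _ , _ , ᴿ.≼-trans (ᴿ.≼-subst (sym (erased-old x Γ)) here) σ≼π , by-side u
    where
      by-side : pv ≡ re a ⊎ pv ≡ re b → ᴿ.CreatedAboveUse F F' (⅋-r eq (subst (Proof R) (erased-premises a b Γ) (erase-proof π₀)))
      by-side (inj₁ pv≡a) = inj₁ F'≡a , _ , _ , ⅋◃ , here F'≡a ,
                            ᴿ.createdIn-subst (erased-premises a b Γ) (createdIn-pv⇒createdIn-F π₀ (ˢ.∈⇒createdIn π₀ (here pv≡a)))
        where F'≡a : F' ≡ a
              F'≡a = re-injective (trans re-F' pv≡a)
      by-side (inj₂ pv≡b) = inj₂ F'≡b , _ , _ , ⅋◃ , there (here F'≡b) ,
                            ᴿ.createdIn-subst (erased-premises a b Γ) (createdIn-pv⇒createdIn-F π₀ (ˢ.∈⇒createdIn π₀ (there (here pv≡b))))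
        where F'≡b : F' ≡ b
              F'≡b = re-injective (trans re-F' pv≡b)
  ... | gadget-par | _ = ⊥-elim ([ j⊥v≢pv ∘ sym , pv≢old F' ]′ u)
  uses-pv⇒aboveUse (⊗J-r e _ isJ _ _) _ u with tensor-link e
  ... | old-tensor {b = b} _ = ⊥-elim (proj₁ (notJ-re b) isJ)
  ... | gadget-tensor = ⊥-elim ([ pv≢old F , jv≢pv ∘ sym ]′ u)
  uses-pv⇒aboveUse (⅋J-r e isJ⊥ _ _) _ u with par-link e
  ... | old-par {a = a} _ = ⊥-elim (proj₂ (notJ-re a) isJ⊥)
  ... | gadget-par = ⊥-elim ([ j⊥v≢pv ∘ sym , pv≢old F' ]′ u)

  creates-parent⇒uses-pv : ∀ {c s} → premAt (link R c) s ≡ just F' → ∀ {Γ} (ρ : Proof S Γ) → Creates S (old c) ρ → Uses S pv ρ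
  creates-parent⇒uses-pv {c} {s} F'◂c = go
    where
      pv◂c : premAt (link S (old c)) s ≡ just pv
      pv◂c = trans (premise-old F'◂c) (cong just re-F')
      not-axiom : ∀ {v w} → old c ≡ v → link S v ≢ ax w
      not-axiom refl e with trans (sym (cong (λ L → premAt L s) e)) pv◂c
      ... | ()
      binary : ∀ {v a b} {L : Link (n + 4)} → old c ≡ v → link S v ≡ L → L ≡ tens a b ⊎ L ≡ par a b → pv ≡ a ⊎ pv ≡ b
      binary refl e = premise-of (trans (sym (cong (λ L → premAt L s) e)) pv◂c)
      go : ∀ {Γ} (ρ : Proof S Γ) → Creates S (old c) ρ → Uses S pv ρ
      go (ax-r e _) (inj₁ c≡v) = ⊥-elim (not-axiom c≡v e)
      go (ax-r {v} {w} e _) (inj₂ c≡w) = ⊥-elim (not-axiom c≡w (ax-sym S v w e))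
      go (⊗-r e _ _) c≡v = binary c≡v e (inj₁ refl)
      go (⅋-r e _) c≡v = binary c≡v e (inj₂ refl)
      go (⊗J-r e e' isJ _ _) c≡ with tensor-link e
      ... | old-tensor {b = b} _ = ⊥-elim (proj₁ (notJ-re b) isJ)
      ... | gadget-tensor with ax-inj (trans (sym link-j) e') | c≡
      ...   | refl | inj₁ c≡tv = ⊥-elim (old≢new c _ c≡tv)
      ...   | refl | inj₂ (inj₁ c≡jv) = ⊥-elim (old≢new c _ c≡jv)
      ...   | refl | inj₂ (inj₂ c≡j⊥v) = ⊥-elim (old≢new c _ c≡j⊥v)
      go (⅋J-r e isJ⊥ _ _) c≡ with par-link e
      ... | old-par {a = a} _ = ⊥-elim (proj₂ (notJ-re a) isJ⊥)
      ... | gadget-par = ⊥-elim (old≢new c _ c≡)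

  renamed-list : ∀ Γ → (∀ {y} → y ∈ Γ → ∃[ x ] y ≡ re x) → ∃[ Γ₀ ] Γ ≡ map re Γ₀
  renamed-list [] _ = [] , refl
  renamed-list (y ∷ Γ) all-renamed with all-renamed (here refl) | renamed-list Γ (all-renamed ∘ there)
  ... | x , refl | Γ₀ , refl = x ∷ Γ₀ , refl

  erase-conclusions : ∀ {Γ} → ConclusionList S Γ → ConclusionList R (erased Γ)
  erase-conclusions {Γ} (unique , ∈⇔conclusion) with renamed-list Γ (conclusion-renamed ∘ Equivalence.to (∈⇔conclusion _))
  ... | Γ₀ , refl = subst (ConclusionList R) (sym (mapMaybe-map-retract erase-re Γ₀)) (Unique.map⁻ unique , λ x → mk⇔ (to x) (from x))
    where
      to : ∀ x → x ∈ Γ₀ → IsConclusion R x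
      to x x∈ = conclusion-re⁻ (Equivalence.to (∈⇔conclusion (re x)) (∈-map⁺ re x∈))
      from : ∀ x → IsConclusion R x → x ∈ Γ₀
      from x c with ∈-map⁻ re (Equivalence.from (∈⇔conclusion (re x)) (conclusion-re c))
      ... | x' , x'∈ , re-x≡re-x' = subst (_∈ Γ₀) (re-injective (sym re-x≡re-x')) x'∈

  forward : Correct S → SeqWithAbove R F F'
  forward σS = σR , above
    where
      πS : Proof S (concl σS)
      πS = proof σS
      clR : ConclusionList R (erased (concl σS))
      clR = erase-conclusions (isConcl σS)
      σR : Sequentialization R
      σR = record { concl = erased (concl σS) ; isConcl = clR ; proof = erase-proof πS }
      above : Above R F F' (erase-proof πS)
      above with premise-or-conclusion F'
      ... | inj₂ F'-conclusion =
        inj₁ (Equivalence.from (proj₂ clR F') F'-conclusion , ᴿ.#created>0⇒createdIn _ (≤-reflexive (sym (created-once clR (erase-proof πS) F))))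
      ... | inj₁ (c , _ , F'◂c) with ˢ.#created>0⇒createdIn πS (≤-reflexive (trans (sym (created-once clR (erase-proof πS) c)) (#created-erase c πS)))
      ...   | _ , ρ , ρ≼πS , creates-c = inj₂ (uses-pv⇒aboveUse ρ ρ≼πS (creates-parent⇒uses-pv F'◂c ρ creates-c))

corollary3p6 : ∀ {n} (R : ProofStructure n) → IsMLL R → (F F' : Fin n) → F ≢ F' →
    Σ (ProofStructure (n + 4)) (JGraft R F F') ×
    (∀ (S : ProofStructure (n + 4)) → JGraft R F F' S → (Correct S ⇔ SeqWithAbove R F F'))
corollary3p6 R mll F F' F≢F' =
  (Construction.S R F F' F≢F' , Construction.S-graft R F F' F≢F') ,
  λ S G → mk⇔ (Grafted.forward R mll F F' F≢F' S G) (Grafted.backward R mll F F' F≢F' S G)
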